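{- For every $\lambda$-theory $\mathcal T$, $\mathrm{FHP}/\mathcal T$ (the set of $\mathcal T$-equivalence classes of finite hereditary permutations) is a submonoid of $(\Lambda/\mathcal T,\circ)$ which is an $F$-inverse monoid.
   Context: $\Lambda$ is the set of $\lambda$-terms; $\mathbf I=\lambda x.x$, $\mathbf B=\lambda fgx.f(gx)$, $M\circ N:=\mathbf BMN$, which induces an associative operation on $\Lambda/\mathcal T$ for any $\lambda$-theory $\mathcal T$ (an equivalence on $\Lambda$ containing $\beta$-conversion, compatible with application and abstraction). For each variable $x$, $\mathscr{HP}(x)$ is the largest set of Böhm-like trees such that every $T\in\mathscr{HP}(x)$ has the form $\lambda x_1\ldots x_n.x\,T_1\cdots T_n$ (root $\lambda x_1\dots x_n.x$, children $T_i$, $x_i$ fresh) for some $n$, some permutation $\pi$ of $\{1,\dots,n\}$, and $T_i\in\mathscr{HP}(x_{\pi i})$; $\mathscr{HP}=\{\lambda x.T:T\in\mathscr{HP}(x)\}$; $\mathrm{FHP}$ is the set of $\lambda$-terms whose Böhm tree is a finite element of $\mathscr{HP}$. An inverse monoid is a monoid with a unary operation $^*$ satisfying $(u^*)^*=u$, $(uv)^*=v^*u^*$, $uu^*u=u$, $uu^*vv^*=vv^*uu^*$; natural order $u\le v$ iff $uu^*v=u$; $\sigma_S$ is the relation $t\,\sigma_S\,u$ iff there is $w$ with $w\le t$ and $w\le u$; $S$ is $F$-inverse if every $\sigma_S$-class has a unique maximal element. -}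

module Defs where

open import Level using (0ℓ)
open import Data.Nat using (ℕ; zero; suc; _+_; _∸_)
open import Data.Fin using (Fin; toℕ) renaming (zero to fzero; suc to fsuc)
open import Data.Fin.Permutation using (Permutation′; _⟨$⟩ʳ_)
open import Data.Product using (Σ; ∃; _×_; _,_)
open import Relation.Binary.PropositionalEquality using (_≡_)
open import Relation.Binary using (Rel; IsEquivalence)
open import Relation.Binary.Construct.Closure.Equivalence using (EqClosure)

-- λ-terms (de Bruijn indices; α-equivalence is syntactic identity)

data Term : Set where
  var : ℕ → Term
  app : Term → Term → Term
  lam : Term → Term

ext : (ℕ → ℕ) → ℕ → ℕ
ext ρ zero    = zero
ext ρ (suc i) = suc (ρ i)

ren : (ℕ → ℕ) → Term → Term
ren ρ (var i)   = var (ρ i)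
ren ρ (app t u) = app (ren ρ t) (ren ρ u)
ren ρ (lam t)   = lam (ren (ext ρ) t)

exts : (ℕ → Term) → ℕ → Term
exts σ zero    = var zero
exts σ (suc i) = ren suc (σ i)

sub : (ℕ → Term) → Term → Term
sub σ (var i)   = σ i
sub σ (app t u) = app (sub σ t) (sub σ u)
sub σ (lam t)   = lam (sub (exts σ) t)

sub0 : Term → ℕ → Term
sub0 s zero    = s
sub0 s (suc i) = var i

data _⟶β_ : Term → Term → Set where
  β     : ∀ {t s} → app (lam t) s ⟶β sub (sub0 s) t
  appˡ  : ∀ {t t′ u} → t ⟶β t′ → app t u ⟶β app t′ u
  appʳ  : ∀ {t u u′} → u ⟶β u′ → app t u ⟶β app t u′
  lamξ  : ∀ {t t′} → t ⟶β t′ → lam t ⟶β lam t′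

_=β_ : Term → Term → Set
_=β_ = EqClosure _⟶β_

record IsLambdaTheory (_≈_ : Rel Term 0ℓ) : Set where
  field
    isEquivalence : IsEquivalence _≈_
    β⊆            : ∀ {M N} → M =β N → M ≈ N
    app-cong      : ∀ {M M′ N N′} → M ≈ M′ → N ≈ N′ → app M N ≈ app M′ N′
    lam-cong      : ∀ {M N} → M ≈ N → lam M ≈ lam N

𝐈 : Term
𝐈 = lam (var 0)

𝐁 : Term
𝐁 = lam (lam (lam (app (var 2) (app (var 1) (var 0)))))

_∘ₗ_ : Term → Term → Term
M ∘ₗ N = app (app 𝐁 M) N

lams : ℕ → Term → Term
lams zero    t = t
lams (suc n) t = lam (lams n t)

apps : ∀ {n} → Term → (Fin n → Term) → Term
apps {zero}  h ts = h
apps {suc n} h ts = apps (app h (ts fzero)) (λ i → ts (fsuc i))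

-- HP k T : T is a finite Böhm-like tree in HP(x), where x is the
-- variable with de Bruijn index k in T's context.
-- T = λx₁…xₙ. x T₁ ⋯ Tₙ with Tᵢ ∈ HP(x_{π i}); inside the n binders,
-- x_{j+1} (j : Fin n) has index n ∸ suc j and x has index n + k.
data HP : ℕ → Term → Set where
  hp : ∀ {k} n (π : Permutation′ n) (ts : Fin n → Term) →
       (∀ i → HP (n ∸ suc (toℕ (π ⟨$⟩ʳ i))) (ts i)) →
       HP k (lams n (apps (var (n + k)) ts))

-- finite elements of 𝓗𝓟 = { λx.T : T ∈ HP(x) }
IsHPnf : Term → Set
IsHPnf N = Σ Term λ T → N ≡ lam T × HP 0 T

-- M ∈ FHP : the Böhm tree of M is a finite element of 𝓗𝓟, i.e. M has a
-- β-normal form which is (the term of) a finite hereditary permutation.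
FHP : Term → Set
FHP M = ∃ λ N → M =β N × IsHPnf N

-- P/≈ (the ≈-classes of elements satisfying P) as a submonoid of
-- (Term/≈, _∙_) which is an F-inverse monoid.

record IsFInverseSubmonoid (P : Term → Set) (_≈_ : Rel Term 0ℓ)
                           (_∙_ : Term → Term → Term) (e : Term) : Set₁ where
  field
    e∈        : ∃ λ z → P z × e ≈ z
    ∙∈        : ∀ {x y} → P x → P y → ∃ λ z → P z × (x ∙ y) ≈ z
    assoc     : ∀ {x y z} → P x → P y → P z → ((x ∙ y) ∙ z) ≈ (x ∙ (y ∙ z))
    identityˡ : ∀ {x} → P x → (e ∙ x) ≈ x
    identityʳ : ∀ {x} → P x → (x ∙ e) ≈ x
    star      : (x : Term) → P x → Term
    star∈     : ∀ {x} (px : P x) → P (star x px)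
    star-cong : ∀ {x y} (px : P x) (py : P y) → x ≈ y → star x px ≈ star y py
    star-inv  : ∀ {x} (px : P x) → star (star x px) (star∈ px) ≈ x
    star-anti : ∀ {x y z} (px : P x) (py : P y) (pz : P z) →
                (x ∙ y) ≈ z → star z pz ≈ (star y py ∙ star x px)
    regular   : ∀ {x} (px : P x) → ((x ∙ star x px) ∙ x) ≈ x
    idem-comm : ∀ {x y} (px : P x) (py : P y) →
                ((x ∙ star x px) ∙ (y ∙ star y py)) ≈ ((y ∙ star y py) ∙ (x ∙ star x px))

  _≤ₙ_ : ∀ {u v} → P u → P v → Set
  _≤ₙ_ {u} {v} pu pv = ((u ∙ star u pu) ∙ v) ≈ u

  σ : ∀ {t u} → P t → P u → Set
  σ {t} {u} pt pu = ∃ λ w → Σ (P w) λ pw → (pw ≤ₙ pt) × (pw ≤ₙ pu)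

  MaxInClass : ∀ {m u} → P m → P u → Set
  MaxInClass {m} pm pu =
    σ pm pu × (∀ {v} (pv : P v) → σ pv pu → pm ≤ₙ pv → v ≈ m)

  field
    F-inverse : ∀ {u} (pu : P u) →
                ∃ λ m → Σ (P m) λ pm → MaxInClass pm pu ×
                  (∀ {m′} (pm′ : P m′) → MaxInClass pm′ pu → m′ ≈ m)

-- A finite hereditary permutation is a tree: a node λx₁…xₙ. x T₁ ⋯ Tₙ records a permutation of
-- x₁ … xₙ (the heads of the Tᵢ) and n subtrees.  Up to β, M ∘ N of two such terms is again one:
-- its tree grafts the tree of N onto the head of the tree of M, composing the permutations at every
-- level (the smaller node is η-expanded to the larger arity).  Inverting every permutation gives an
-- inverse, and the idempotents are the trees whose permutations are all identities, so they commute;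
-- hence the trees form an inverse monoid already up to β, and star is well defined modulo any
-- λ-theory because inverses in an inverse semigroup are unique.  For F-inversity, u ≤ v forces the
-- trees of u and v to be η-equivalent, unless they are apart, in which case a Böhm-out context
-- shows the theory to be inconsistent.  So a σ-class lies in one η-class, whose η-normal form is
-- above every member; it is the unique maximal element.

{-# OPTIONS --safe #-}
module Submission where

open import Defs
open import Level using (0ℓ)
open import Function using (id; _∘_)
open import Relation.Binary using (Rel; IsEquivalence)
import Relation.Binary.Reasoning.Setoid as SetoidReasoning
open import Algebra.Bundles using (Semigroup)
open import Relation.Binary.PropositionalEquality using (_≡_; _≢_; refl; sym; trans; cong; cong₂; subst; module ≡-Reasoning)
open import Relation.Binary.Construct.Closure.ReflexiveTransitive as Star using (Star; ε; _◅_; _◅◅_)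
open import Relation.Binary.Construct.Closure.Symmetric using (fwd)
open import Relation.Binary.Construct.Closure.ReflexiveTransitive.Properties using (module StarReasoning)
open import Relation.Nullary using (¬_; Dec; yes; no; contradiction)
open import Data.Nat using (ℕ; zero; suc; _+_; _∸_; _⊔_; _≤_; _<_; z≤n; s≤s; z<s; s≤s⁻¹)
open import Data.Nat.Properties
open import Data.List using (List; []; _∷_; _++_; foldl; applyUpTo)
open import Data.List.Properties using (foldl-++)
open import Data.Product using (Σ; ∃; _×_; _,_; proj₁; proj₂)
open import Data.Sum using (_⊎_; inj₁; inj₂)
open import Data.Fin using (Fin; toℕ; fromℕ<) renaming (zero to fzero; suc to fsuc)
open import Data.Fin.Properties using (toℕ-fromℕ<; fromℕ<-toℕ; toℕ<n; toℕ-injective)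
open import Data.Fin.Permutation using (Permutation′; _⟨$⟩ʳ_; _⟨$⟩ˡ_; permutation)
import Data.Fin.Permutation as Perm

∸-suc-< : ∀ {k n} → k < n → n ∸ suc k < n
∸-suc-< = ∸-monoʳ-< z<s

[m+n]∸[1+o]≡n+[m∸[1+o]] : ∀ m n {o} → o < m → (m + n) ∸ suc o ≡ n + (m ∸ suc o)
[m+n]∸[1+o]≡n+[m∸[1+o]] m n {o} o<m = trans (cong (_∸ suc o) (+-comm m n)) (+-∸-assoc n o<m)

[m+n]∸[1+o]<n : ∀ {m n o} → m ≤ o → o < m + n → (m + n) ∸ suc o < n
[m+n]∸[1+o]<n {m} {n} m≤o o<m+n with m≤n⇒∃[o]m+o≡n m≤o
... | e , refl = subst (_< n) (sym (trans (cong ((m + n) ∸_) (sym (+-suc m e))) ([m+n]∸[m+o]≡n∸o m n (suc e))))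
                   (∸-suc-< (+-cancelˡ-< m e n o<m+n))

-- Renaming and substitution

ext-cong : ∀ {ρ ρ′} → (∀ i → ρ i ≡ ρ′ i) → ∀ i → ext ρ i ≡ ext ρ′ i
ext-cong h zero    = refl
ext-cong h (suc i) = cong suc (h i)

exts-cong : ∀ {σ σ′} → (∀ i → σ i ≡ σ′ i) → ∀ i → exts σ i ≡ exts σ′ i
exts-cong h zero    = refl
exts-cong h (suc i) = cong (ren suc) (h i)

ren-cong : ∀ {ρ ρ′} → (∀ i → ρ i ≡ ρ′ i) → ∀ t → ren ρ t ≡ ren ρ′ t
ren-cong h (var i)   = cong var (h i)
ren-cong h (app t u) = cong₂ app (ren-cong h t) (ren-cong h u)
ren-cong h (lam t)   = cong lam (ren-cong (ext-cong h) t)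

sub-cong : ∀ {σ σ′} → (∀ i → σ i ≡ σ′ i) → ∀ t → sub σ t ≡ sub σ′ t
sub-cong h (var i)   = h i
sub-cong h (app t u) = cong₂ app (sub-cong h t) (sub-cong h u)
sub-cong h (lam t)   = cong lam (sub-cong (exts-cong h) t)

ren-ren : ∀ ρ ρ′ t → ren ρ (ren ρ′ t) ≡ ren (ρ ∘ ρ′) t
ren-ren ρ ρ′ (var i)   = refl
ren-ren ρ ρ′ (app t u) = cong₂ app (ren-ren ρ ρ′ t) (ren-ren ρ ρ′ u)
ren-ren ρ ρ′ (lam t)   =
  cong lam (trans (ren-ren (ext ρ) (ext ρ′) t) (ren-cong (λ { zero → refl ; (suc i) → refl }) t))

sub-ren : ∀ σ ρ t → sub σ (ren ρ t) ≡ sub (σ ∘ ρ) t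
sub-ren σ ρ (var i)   = refl
sub-ren σ ρ (app t u) = cong₂ app (sub-ren σ ρ t) (sub-ren σ ρ u)
sub-ren σ ρ (lam t)   =
  cong lam (trans (sub-ren (exts σ) (ext ρ) t) (sub-cong (λ { zero → refl ; (suc i) → refl }) t))

ren-sub : ∀ ρ σ t → ren ρ (sub σ t) ≡ sub (ren ρ ∘ σ) t
ren-sub ρ σ (var i)   = refl
ren-sub ρ σ (app t u) = cong₂ app (ren-sub ρ σ t) (ren-sub ρ σ u)
ren-sub ρ σ (lam t)   = cong lam (trans (ren-sub (ext ρ) (exts σ) t) (sub-cong ren-exts t))
  where
  ren-exts : ∀ i → ren (ext ρ) (exts σ i) ≡ exts (ren ρ ∘ σ) i
  ren-exts zero    = refl
  ren-exts (suc i) = trans (ren-ren (ext ρ) suc (σ i)) (sym (ren-ren suc ρ (σ i)))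

sub-sub : ∀ σ τ t → sub σ (sub τ t) ≡ sub (sub σ ∘ τ) t
sub-sub σ τ (var i)   = refl
sub-sub σ τ (app t u) = cong₂ app (sub-sub σ τ t) (sub-sub σ τ u)
sub-sub σ τ (lam t)   = cong lam (trans (sub-sub (exts σ) (exts τ) t) (sub-cong sub-exts t))
  where
  sub-exts : ∀ i → sub (exts σ) (exts τ i) ≡ exts (sub σ ∘ τ) i
  sub-exts zero    = refl
  sub-exts (suc i) = trans (sub-ren (exts σ) suc (τ i)) (sym (ren-sub suc σ (τ i)))

sub-id : ∀ t → sub var t ≡ t
sub-id (var i)   = refl
sub-id (app t u) = cong₂ app (sub-id t) (sub-id u)
sub-id (lam t)   = cong lam (trans (sub-cong (λ { zero → refl ; (suc i) → refl }) t) (sub-id t))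

ren-as-sub : ∀ ρ t → ren ρ t ≡ sub (var ∘ ρ) t
ren-as-sub ρ t = trans (sym (sub-id (ren ρ t))) (sub-ren var ρ t)

ren-id : ∀ t → ren id t ≡ t
ren-id t = trans (ren-as-sub id t) (sub-id t)

infix 4 _⟶*_
_⟶*_ : Rel Term 0ℓ
_⟶*_ = Star _⟶β_

≡⇒⟶* : ∀ {a b} → a ≡ b → a ⟶* b
≡⇒⟶* refl = ε

appˡ* : ∀ {t t′ u} → t ⟶* t′ → app t u ⟶* app t′ u
appˡ* = Star.gmap _ appˡ

appʳ* : ∀ {t u u′} → u ⟶* u′ → app t u ⟶* app t u′
appʳ* = Star.gmap _ appʳ

lam* : ∀ {t t′} → t ⟶* t′ → lam t ⟶* lam t′
lam* = Star.gmap _ lamξ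

⟶*⇒=β : ∀ {a b} → a ⟶* b → a =β b
⟶*⇒=β = Star.map fwd

exts^ : ℕ → (ℕ → Term) → ℕ → Term
exts^ zero    σ = σ
exts^ (suc n) σ = exts (exts^ n σ)

exts^-exts : ∀ n σ i → exts^ n (exts σ) i ≡ exts (exts^ n σ) i
exts^-exts zero    σ i = refl
exts^-exts (suc n) σ i = exts-cong (exts^-exts n σ) i

exts^-< : ∀ n σ i → i < n → exts^ n σ i ≡ var i
exts^-< (suc n) σ zero    _         = refl
exts^-< (suc n) σ (suc i) (s≤s i<n) = cong (ren suc) (exts^-< n σ i i<n)

exts^-+ : ∀ n σ k → exts^ n σ (n + k) ≡ ren (n +_) (σ k)
exts^-+ zero    σ k = sym (ren-id (σ k))
exts^-+ (suc n) σ k = trans (cong (ren suc) (exts^-+ n σ k)) (ren-ren suc (n +_) (σ k))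

sub-lams : ∀ n σ t → sub σ (lams n t) ≡ lams n (sub (exts^ n σ) t)
sub-lams zero    σ t = refl
sub-lams (suc n) σ t =
  cong lam (trans (sub-lams n (exts σ) t) (cong (lams n) (sub-cong (exts^-exts n σ) t)))

lams-+ : ∀ r d t → lams (r + d) t ≡ lams r (lams d t)
lams-+ zero    d t = refl
lams-+ (suc r) d t = cong lam (lams-+ r d t)

lams* : ∀ n {t t′} → t ⟶* t′ → lams n t ⟶* lams n t′
lams* zero    s = s
lams* (suc n) s = lam* (lams* n s)

appsN : ℕ → Term → (ℕ → Term) → Term
appsN n h c = foldl app h (applyUpTo c n)

apps≡appsN : ∀ n h (f : ℕ → Term) → apps {n} h (f ∘ toℕ) ≡ appsN n h f
apps≡appsN zero    h f = refl
apps≡appsN (suc n) h f = apps≡appsN n (app h (f 0)) (f ∘ suc)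

appsN-+ : ∀ m d h c → appsN (m + d) h c ≡ appsN d (appsN m h c) (c ∘ (m +_))
appsN-+ zero    d h c = refl
appsN-+ (suc m) d h c = appsN-+ m d (app h (c 0)) (c ∘ suc)

sub-appsN : ∀ σ n h c → sub σ (appsN n h c) ≡ appsN n (sub σ h) (sub σ ∘ c)
sub-appsN σ zero    h c = refl
sub-appsN σ (suc n) h c = sub-appsN σ n (app h (c 0)) (c ∘ suc)

appsN-cong : ∀ n h {c c′} → (∀ k → k < n → c k ≡ c′ k) → appsN n h c ≡ appsN n h c′
appsN-cong zero    h e = refl
appsN-cong (suc n) h e rewrite e 0 z<s = appsN-cong n _ (λ k k<n → e (suc k) (s≤s k<n))

foldl-app⟶*ˡ : ∀ {h h′} xs → h ⟶* h′ → foldl app h xs ⟶* foldl app h′ xs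
foldl-app⟶*ˡ []       s = s
foldl-app⟶*ˡ (x ∷ xs) s = foldl-app⟶*ˡ xs (appˡ* s)

appsN⟶*ˡ : ∀ n {h h′} c → h ⟶* h′ → appsN n h c ⟶* appsN n h′ c
appsN⟶*ˡ n c = foldl-app⟶*ˡ (applyUpTo c n)

appsN⟶*ʳ : ∀ n h {c c′} → (∀ k → k < n → c k ⟶* c′ k) → appsN n h c ⟶* appsN n h c′
appsN⟶*ʳ zero    h e = ε
appsN⟶*ʳ (suc n) h {c} e =
  appsN⟶*ˡ n (c ∘ suc) (appʳ* (e 0 z<s)) ◅◅ appsN⟶*ʳ n _ (λ k k<n → e (suc k) (s≤s k<n))

-- The substitution performed by applying lams r B to c 0, …, c (r ∸ 1): index r ∸ suc q becomes c q
-- and index r + k becomes var k.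
args : ℕ → (ℕ → Term) → ℕ → Term
args zero    c = var
args (suc r) c i = sub (args r (c ∘ suc)) (exts^ r (sub0 (c 0)) i)

β-appsN-lams : ∀ r B c → appsN r (lams r B) c ⟶* sub (args r c) B
β-appsN-lams zero    B c = ≡⇒⟶* (sym (sub-id B))
β-appsN-lams (suc r) B c =
  appsN⟶*ˡ r (c ∘ suc) (β ◅ ε)
  ◅◅ ≡⇒⟶* (cong (λ t → appsN r t (c ∘ suc)) (sub-lams r (sub0 (c 0)) B))
  ◅◅ β-appsN-lams r _ (c ∘ suc)
  ◅◅ ≡⇒⟶* (sub-sub (args r (c ∘ suc)) (exts^ r (sub0 (c 0))) B)

args-+ : ∀ r c k → args r c (r + k) ≡ var k
args-+ zero    c k = refl
args-+ (suc r) c k rewrite sym (+-suc r k) =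
  trans (cong (sub (args r (c ∘ suc))) (exts^-+ r (sub0 (c 0)) (suc k))) (args-+ r (c ∘ suc) k)

args-< : ∀ r c q → q < r → args r c (r ∸ suc q) ≡ c q
args-< (suc r) c zero _ = begin
  sub (args r (c ∘ suc)) (exts^ r (sub0 (c 0)) r)
    ≡⟨ cong (sub (args r (c ∘ suc)) ∘ exts^ r (sub0 (c 0))) (sym (+-identityʳ r)) ⟩
  sub (args r (c ∘ suc)) (exts^ r (sub0 (c 0)) (r + 0)) ≡⟨ cong (sub _) (exts^-+ r (sub0 (c 0)) 0) ⟩
  sub (args r (c ∘ suc)) (ren (r +_) (c 0))
    ≡⟨ sub-ren _ (r +_) (c 0) ⟩
  sub (args r (c ∘ suc) ∘ (r +_)) (c 0)
    ≡⟨ sub-cong (args-+ r (c ∘ suc)) (c 0) ⟩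
  sub var (c 0)
    ≡⟨ sub-id (c 0) ⟩
  c 0                                                   ∎
  where open ≡-Reasoning
args-< (suc r) c (suc q) (s≤s q<r) =
  trans (cong (sub (args r (c ∘ suc))) (exts^-< r (sub0 (c 0)) (r ∸ suc q) (∸-suc-< q<r)))
        (args-< r (c ∘ suc) q q<r)

exts^-args-+ : ∀ d r c k → exts^ d (args r c) (d + (r + k)) ≡ var (d + k)
exts^-args-+ d r c k = trans (exts^-+ d (args r c) (r + k)) (cong (ren (d +_)) (args-+ r c k))

-- Finite permutations of ℕ

record IsPermBelow (n : ℕ) (f g : ℕ → ℕ) : Set where
  field
    fixed    : ∀ k → n ≤ k → f k ≡ k
    inverseˡ : ∀ k → f (g k) ≡ k
    inverseʳ : ∀ k → g (f k) ≡ k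

  fixed⁻¹ : ∀ k → n ≤ k → g k ≡ k
  fixed⁻¹ k n≤k = trans (cong g (sym (fixed k n≤k))) (inverseʳ k)

  <n : ∀ k → k < n → f k < n
  <n k k<n with f k <? n
  ... | yes fk<n = fk<n
  ... | no fk≮n = contradiction (subst (n ≤_) fk≡k n≤fk) (<⇒≱ k<n)
    where
    n≤fk = ≮⇒≥ fk≮n
    fk≡k = trans (sym (fixed⁻¹ _ n≤fk)) (inverseʳ k)

  <n⁻¹ : ∀ k → k < n → g k < n
  <n⁻¹ k k<n with g k <? n
  ... | yes gk<n = gk<n
  ... | no gk≮n = contradiction (subst (n ≤_) gk≡k n≤gk) (<⇒≱ k<n)
    where
    n≤gk = ≮⇒≥ gk≮n
    gk≡k = trans (sym (fixed _ n≤gk)) (inverseˡ k)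

module _ {n f g} (π : IsPermBelow n f g) where
  open IsPermBelow π

  IsPermBelow-sym : IsPermBelow n g f
  IsPermBelow-sym = record { fixed = fixed⁻¹ ; inverseˡ = inverseʳ ; inverseʳ = inverseˡ }

  IsPermBelow-weaken : ∀ {N} → n ≤ N → IsPermBelow N f g
  IsPermBelow-weaken n≤N = record
    { fixed = λ k N≤k → fixed k (≤-trans n≤N N≤k) ; inverseˡ = inverseˡ ; inverseʳ = inverseʳ }

inverse-≗ : ∀ {f f⁻¹ g g⁻¹ : ℕ → ℕ} → (∀ k → f⁻¹ (f k) ≡ k) → (∀ k → g (g⁻¹ k) ≡ k) →
            (∀ k → f k ≡ g k) → ∀ k → f⁻¹ k ≡ g⁻¹ k
inverse-≗ {f} {f⁻¹} {g} {g⁻¹} f⁻¹∘f g∘g⁻¹ f≗g k = begin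
  f⁻¹ k             ≡⟨ cong f⁻¹ (g∘g⁻¹ k) ⟨
  f⁻¹ (g (g⁻¹ k))   ≡⟨ cong f⁻¹ (f≗g (g⁻¹ k)) ⟨
  f⁻¹ (f (g⁻¹ k))   ≡⟨ f⁻¹∘f (g⁻¹ k) ⟩
  g⁻¹ k             ∎
  where open ≡-Reasoning

IsPermBelow-∘ : ∀ {n f g f′ g′} → IsPermBelow n f g → IsPermBelow n f′ g′ → IsPermBelow n (f ∘ f′) (g′ ∘ g)
IsPermBelow-∘ {f = f} {g} {f′} {g′} π ρ = record
  { fixed    = λ k n≤k → trans (cong f (ρ.fixed k n≤k)) (π.fixed k n≤k)
  ; inverseˡ = λ k → trans (cong f (ρ.inverseˡ (g k))) (π.inverseˡ k)
  ; inverseʳ = λ k → trans (cong g′ (π.inverseʳ (f′ k))) (ρ.inverseʳ k)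
  }
  where
  module π = IsPermBelow π
  module ρ = IsPermBelow ρ

-- Böhm-like trees of hereditary permutations

-- node n π π⁻¹ A is λx₁…xₙ. x T₀ ⋯ Tₙ₋₁ where Tᵢ = A i has head x_{π i + 1}; beyond n, π is the
-- identity and A is leaf.  The bare head variable x is leaf, not node 0.
data Tree : Set where
  leaf : Tree
  node : (n : ℕ) (π π⁻¹ : ℕ → ℕ) (A : ℕ → Tree) → Tree

record IsNode (n : ℕ) (π π⁻¹ : ℕ → ℕ) (A : ℕ → Tree) : Set where
  field
    positive : 1 ≤ n
    perm     : IsPermBelow n π π⁻¹
    leaves   : ∀ k → n ≤ k → A k ≡ leaf
  open IsPermBelow perm public

data WF : Tree → Set where
  wf-leaf : WF leaf
  wf-node : ∀ {n π π⁻¹ A} → IsNode n π π⁻¹ A → (∀ k → WF (A k)) → WF (node n π π⁻¹ A)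

-- term k X realises X with head variable of index k, as in HP k.
term : ℕ → Tree → Term
term k leaf             = var k
term k (node n π π⁻¹ A) = lams n (appsN n (var (n + k)) (λ i → term (n ∸ suc (π i)) (A i)))

children : ℕ → (ℕ → ℕ) → (ℕ → Tree) → ℕ → Term
children n π A i = term (n ∸ suc (π i)) (A i)

plug : Tree → Term → Term
plug leaf             M = M
plug (node n π π⁻¹ A) M = lams n (appsN n (ren (n +_) M) (children n π A))

plug-var : ∀ X j → plug X (var j) ≡ term j X
plug-var leaf             j = refl
plug-var (node n π π⁻¹ A) j = refl

sub-term : ∀ X σ k → WF X → sub σ (term k X) ≡ plug X (σ k)
sub-term leaf             σ k _                 = refl
sub-term (node n π π⁻¹ A) σ k (wf-node isN wfA) = begin
  sub σ (lams n (appsN n (var (n + k)) (children n π A)))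
    ≡⟨ sub-lams n σ _ ⟩
  lams n (sub (exts^ n σ) (appsN n (var (n + k)) (children n π A)))
    ≡⟨ cong (lams n) (sub-appsN (exts^ n σ) n _ _) ⟩
  lams n (appsN n (exts^ n σ (n + k)) (sub (exts^ n σ) ∘ children n π A))
    ≡⟨ cong (lams n) (cong₂ (appsN n) (exts^-+ n σ k) refl) ⟩
  lams n (appsN n (ren (n +_) (σ k)) (sub (exts^ n σ) ∘ children n π A))
    ≡⟨ cong (lams n) (appsN-cong n _ child) ⟩
  lams n (appsN n (ren (n +_) (σ k)) (children n π A))
    ∎
  where
  open ≡-Reasoning
  open IsNode isN
  child : ∀ i → i < n → sub (exts^ n σ) (children n π A i) ≡ children n π A i
  child i i<n = trans (sub-term (A i) (exts^ n σ) _ (wfA i))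
                      (trans (cong (plug (A i)) (exts^-< n σ _ (∸-suc-< (<n i i<n)))) (plug-var (A i) _))

ren-term : ∀ X ρ k → WF X → ren ρ (term k X) ≡ term (ρ k) X
ren-term X ρ k wfX = trans (ren-as-sub ρ (term k X)) (trans (sub-term X _ k wfX) (plug-var X (ρ k)))

infixl 7 _⊙_
_⊙_ : Tree → Tree → Tree
leaf             ⊙ Y                = Y
node r p p⁻¹ A   ⊙ leaf             = node r p p⁻¹ A
node r p p⁻¹ A   ⊙ node m q q⁻¹ S   = node (r ⊔ m) (p ∘ q) (q⁻¹ ∘ p⁻¹) (λ l → S l ⊙ A (q l))

⊙-identityʳ : ∀ X → X ⊙ leaf ≡ X
⊙-identityʳ leaf             = refl
⊙-identityʳ (node n π π⁻¹ A) = refl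

PlugReduces : Tree → Tree → Set
PlugReduces X Y = ∀ j → plug X (term j Y) ⟶* term j (X ⊙ Y)

module _ (p p⁻¹ q q⁻¹ : ℕ → ℕ) (A S : ℕ → Tree) (ih : ∀ l → PlugReduces (S l) (A (q l))) where
  open StarReasoning _⟶β_

  -- The m binders of the inner tree consume the first m of the r = m + d arguments.
  private
    composite : ℕ → Tree
    composite N = node N (p ∘ q) (q⁻¹ ∘ p⁻¹) (λ l → S l ⊙ A (q l))

    resize : ∀ {N N′} j → N ≡ N′ → term j (composite N) ⟶* term j (composite N′)
    resize j refl = ε

  plug-term-≥ : ∀ m d → IsNode m q q⁻¹ S → (∀ l → WF (S l)) → PlugReduces (node (m + d) p p⁻¹ A) (node m q q⁻¹ S)
  plug-term-≥ m d isS wfS j = lams* r (begin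
    appsN r (ren (r +_) (term j Y)) c
      ≡⟨ cong (λ h → appsN r h c) (ren-term Y (r +_) j (wf-node isS wfS)) ⟩
    appsN (m + d) (lams m B) c
      ≡⟨ appsN-+ m d _ c ⟩
    appsN d (appsN m (lams m B) c) (c ∘ (m +_))
      ⟶*⟨ appsN⟶*ˡ d _ (β-appsN-lams m B c) ⟩
    appsN d (sub (args m c) B) (c ∘ (m +_))
      ≡⟨ cong (λ t → appsN d t (c ∘ (m +_))) substituted ⟩
    appsN d (appsN m (var (r + j)) (sub (args m c) ∘ children m q S)) (c ∘ (m +_))
      ⟶*⟨ appsN⟶*ˡ d _ (appsN⟶*ʳ m _ child) ⟩
    appsN d (appsN m (var (r + j)) H) (c ∘ (m +_))
      ≡⟨ appsN-cong d _ unused ⟩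
    appsN d (appsN m (var (r + j)) H) (H ∘ (m +_))
      ≡⟨ appsN-+ m d _ H ⟨
    appsN r (var (r + j)) H                         ∎) ◅◅ resize j (sym (m≥n⇒m⊔n≡m (m≤m+n m d)))
    where
    r = m + d
    Y = node m q q⁻¹ S
    c = children r p A
    B = appsN m (var (m + (r + j))) (children m q S)
    H = children r (p ∘ q) (λ l → S l ⊙ A (q l))
    open IsNode isS
    substituted : sub (args m c) B ≡ appsN m (var (r + j)) (sub (args m c) ∘ children m q S)
    substituted = trans (sub-appsN (args m c) m _ _)
                        (cong (λ h → appsN m h (sub (args m c) ∘ children m q S)) (args-+ m c (r + j)))
    child : ∀ l → l < m → sub (args m c) (children m q S l) ⟶* H l
    child l l<m = ≡⇒⟶* (trans (sub-term (S l) (args m c) _ (wfS l))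
                              (cong (plug (S l)) (args-< m c (q l) (<n l l<m))))
                  ◅◅ ih l _
    unused : ∀ k → k < d → c (m + k) ≡ H (m + k)
    unused k _ rewrite fixed (m + k) (m≤m+n m k) | leaves (m + k) (m≤m+n m k) = refl

  private
    module Children-≤ (r d : ℕ) (isA : IsNode r p p⁻¹ A) (wfA : ∀ k → WF (A k)) (isS : IsNode (r + d) q q⁻¹ S)
             (wfS : ∀ l → WF (S l)) where
      c = children r p A
      σ = exts^ d (args r c)
      H = children (r + d) (p ∘ q) (λ l → S l ⊙ A (q l))
      module A = IsNode isA
      module S = IsNode isS

      -- A child pointing to one of the r consumed binders receives the corresponding argument;
      -- one pointing to the d remaining binders keeps its head variable.
      reduce : ∀ l → l < r + d → sub σ (children (r + d) q S l) ⟶* H l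
      reduce l l<r+d with q l <? r
      ... | yes ql<r = begin
        sub σ (children (r + d) q S l)
          ≡⟨ sub-term (S l) σ _ (wfS l) ⟩
        plug (S l) (σ ((r + d) ∸ suc (q l)))
          ≡⟨ cong (plug (S l) ∘ σ) ([m+n]∸[1+o]≡n+[m∸[1+o]] r d ql<r) ⟩
        plug (S l) (σ (d + (r ∸ suc (q l))))
          ≡⟨ cong (plug (S l)) (exts^-+ d (args r c) (r ∸ suc (q l))) ⟩
        plug (S l) (ren (d +_) (args r c (r ∸ suc (q l))))
          ≡⟨ cong (plug (S l) ∘ ren (d +_)) (args-< r c (q l) ql<r) ⟩
        plug (S l) (ren (d +_) (c (q l)))
          ≡⟨ cong (plug (S l)) (ren-term (A (q l)) (d +_) _ (wfA (q l))) ⟩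
        plug (S l) (term (d + (r ∸ suc (p (q l)))) (A (q l)))
          ⟶*⟨ ih l _ ⟩
        term (d + (r ∸ suc (p (q l)))) (S l ⊙ A (q l))
          ≡⟨ cong (λ i → term i (S l ⊙ A (q l))) ([m+n]∸[1+o]≡n+[m∸[1+o]] r d (A.<n (q l) ql<r)) ⟨
        H l                                                     ∎
      ... | no ql≮r = begin
        sub σ (children (r + d) q S l)
          ≡⟨ sub-term (S l) σ _ (wfS l) ⟩
        plug (S l) (σ ((r + d) ∸ suc (q l)))
          ≡⟨ cong (plug (S l)) (exts^-< d (args r c) _ ([m+n]∸[1+o]<n r≤ql (S.<n l l<r+d))) ⟩
        plug (S l) (var ((r + d) ∸ suc (q l)))
          ≡⟨ plug-var (S l) _ ⟩
        term ((r + d) ∸ suc (q l)) (S l)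
          ≡⟨ cong (term _) (⊙-identityʳ (S l)) ⟨
        term ((r + d) ∸ suc (q l)) (S l ⊙ leaf)
          ≡⟨ cong₂ (λ i X → term ((r + d) ∸ suc i) (S l ⊙ X)) (A.fixed (q l) r≤ql) (A.leaves (q l) r≤ql) ⟨
        H l                                      ∎
        where r≤ql = ≮⇒≥ ql≮r

  -- Only the first r of the r + d binders of the inner tree are consumed; the other d stay in front.
  plug-term-≤ : ∀ r d → IsNode r p p⁻¹ A → (∀ k → WF (A k)) → IsNode (r + d) q q⁻¹ S → (∀ l → WF (S l)) →
                PlugReduces (node r p p⁻¹ A) (node (r + d) q q⁻¹ S)
  plug-term-≤ r d isA wfA isS wfS j = begin
    lams r (appsN r (ren (r +_) (term j Y)) c)
      ≡⟨ cong (λ h → lams r (appsN r h c)) (ren-term Y (r +_) j (wf-node isS wfS)) ⟩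
    lams r (appsN r (lams (r + d) B) c)
      ≡⟨ cong (λ t → lams r (appsN r t c)) (lams-+ r d B) ⟩
    lams r (appsN r (lams r (lams d B)) c)
      ⟶*⟨ lams* r (β-appsN-lams r (lams d B) c) ⟩
    lams r (sub (args r c) (lams d B))
      ≡⟨ cong (lams r) (sub-lams d (args r c) B) ⟩
    lams r (lams d (sub σ B))
      ≡⟨ cong (lams r ∘ lams d) substituted ⟩
    lams r (lams d (appsN (r + d) (var ((r + d) + j)) (sub σ ∘ children (r + d) q S)))
      ⟶*⟨ lams* r (lams* d (appsN⟶*ʳ (r + d) _ (Children-≤.reduce r d isA wfA isS wfS))) ⟩
    lams r (lams d (appsN (r + d) (var ((r + d) + j)) H)) ≡⟨ lams-+ r d _ ⟨
    lams (r + d) (appsN (r + d) (var ((r + d) + j)) H) ⟶*⟨ resize j (sym (m≤n⇒m⊔n≡n (m≤m+n r d))) ⟩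
    term j (node r p p⁻¹ A ⊙ node (r + d) q q⁻¹ S)    ∎
    where
    Y = node (r + d) q q⁻¹ S
    c = children r p A
    σ = exts^ d (args r c)
    B = appsN (r + d) (var ((r + d) + (r + j))) (children (r + d) q S)
    H = children (r + d) (p ∘ q) (λ l → S l ⊙ A (q l))
    head : σ ((r + d) + (r + j)) ≡ var ((r + d) + j)
    head = trans (cong σ (trans (cong (_+ (r + j)) (+-comm r d)) (+-assoc d r (r + j))))
                 (trans (exts^-args-+ d r c (r + j))
                        (cong var (trans (sym (+-assoc d r j)) (cong (_+ j) (+-comm d r)))))
    substituted : sub σ B ≡ appsN (r + d) (var ((r + d) + j)) (sub σ ∘ children (r + d) q S)
    substituted = trans (sub-appsN σ (r + d) _ _)
                        (cong (λ h → appsN (r + d) h (sub σ ∘ children (r + d) q S)) head)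

plug-term : ∀ X Y → WF X → WF Y → PlugReduces X Y
plug-term leaf             Y    _ _ j = ε
plug-term (node r p p⁻¹ A) leaf _ _ j = ε
plug-term (node r p p⁻¹ A) (node m q q⁻¹ S) (wf-node isA wfA) (wf-node isS wfS) j with ≤-total m r
... | inj₁ m≤r with m≤n⇒∃[o]m+o≡n m≤r
...   | d , refl = plug-term-≥ p p⁻¹ q q⁻¹ A S ih m d isS wfS j
  where
  ih : ∀ l → PlugReduces (S l) (A (q l))
  ih l = plug-term (S l) (A (q l)) (wfS l) (wfA (q l))
plug-term (node r p p⁻¹ A) (node m q q⁻¹ S) (wf-node isA wfA) (wf-node isS wfS) j | inj₂ r≤m with m≤n⇒∃[o]m+o≡n r≤m
...   | d , refl = plug-term-≤ p p⁻¹ q q⁻¹ A S ih r d isA wfA isS wfS j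
  where
  ih : ∀ l → PlugReduces (S l) (A (q l))
  ih l = plug-term (S l) (A (q l)) (wfS l) (wfA (q l))

Closed : Term → Set
Closed M = ∀ σ → sub σ M ≡ M

Closed-ren : ∀ {M} → Closed M → ∀ ρ → ren ρ M ≡ M
Closed-ren closed ρ = trans (ren-as-sub ρ _) (closed _)

∘ₗ⟶* : ∀ {M N} → Closed M → Closed N → M ∘ₗ N ⟶* lam (app M (app N (var 0)))
∘ₗ⟶* {M} {N} closedM closedN =
  appˡ* (β ◅ ε) ◅◅ β ◅
  ≡⇒⟶* (cong₂ (λ M′ N′ → lam (app M′ (app N′ (var 0)))) M-unchanged (Closed-ren closedN suc))
  where
  M-unchanged : sub (exts (sub0 N)) (ren suc (ren suc M)) ≡ M
  M-unchanged rewrite Closed-ren closedM suc | Closed-ren closedM suc = closedM _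

⟦_⟧ : Tree → Term
⟦ X ⟧ = lam (term 0 X)

⟦⟧-closed : ∀ {X} → WF X → Closed ⟦ X ⟧
⟦⟧-closed {X} wfX σ = cong lam (trans (sub-term X (exts σ) 0 wfX) (plug-var X 0))

app-⟦⟧⟶* : ∀ {X} M → WF X → app ⟦ X ⟧ M ⟶* plug X M
app-⟦⟧⟶* {X} M wfX = β ◅ ≡⇒⟶* (sub-term X (sub0 M) 0 wfX)

⟦⟧-∘ₗ⟶* : ∀ {X Y} → WF X → WF Y → ⟦ X ⟧ ∘ₗ ⟦ Y ⟧ ⟶* ⟦ X ⊙ Y ⟧
⟦⟧-∘ₗ⟶* {X} {Y} wfX wfY = begin
  ⟦ X ⟧ ∘ₗ ⟦ Y ⟧                      ⟶*⟨ ∘ₗ⟶* (⟦⟧-closed wfX) (⟦⟧-closed wfY) ⟩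
  lam (app ⟦ X ⟧ (app ⟦ Y ⟧ (var 0)))  ⟶*⟨ lam* (appʳ* (app-⟦⟧⟶* (var 0) wfY)) ⟩
  lam (app ⟦ X ⟧ (plug Y (var 0)))     ≡⟨ cong (lam ∘ app ⟦ X ⟧) (plug-var Y 0) ⟩
  lam (app ⟦ X ⟧ (term 0 Y))           ⟶*⟨ lam* (app-⟦⟧⟶* (term 0 Y) wfX) ⟩
  lam (plug X (term 0 Y))              ⟶*⟨ lam* (plug-term X Y wfX wfY 0) ⟩
  ⟦ X ⊙ Y ⟧                            ∎
  where open StarReasoning _⟶β_

-- The inverse monoid of trees

infix 4 _≈ᵀ_
data _≈ᵀ_ : Tree → Tree → Set where
  leaf≈ : leaf ≈ᵀ leaf
  node≈ : ∀ {n p p⁻¹ A m q q⁻¹ B} → n ≡ m → (∀ k → p k ≡ q k) → (∀ k → p⁻¹ k ≡ q⁻¹ k) → (∀ k → A k ≈ᵀ B k) →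
          node n p p⁻¹ A ≈ᵀ node m q q⁻¹ B

≈ᵀ-refl : ∀ {X} → X ≈ᵀ X
≈ᵀ-refl {leaf}             = leaf≈
≈ᵀ-refl {node n π π⁻¹ A}   = node≈ refl (λ _ → refl) (λ _ → refl) (λ _ → ≈ᵀ-refl)

≈ᵀ-reflexive : ∀ {X Y} → X ≡ Y → X ≈ᵀ Y
≈ᵀ-reflexive refl = ≈ᵀ-refl

≈ᵀ-sym : ∀ {X Y} → X ≈ᵀ Y → Y ≈ᵀ X
≈ᵀ-sym leaf≈                = leaf≈
≈ᵀ-sym (node≈ n≡m p≗q p⁻¹≗q⁻¹ A≈B) = node≈ (sym n≡m) (sym ∘ p≗q) (sym ∘ p⁻¹≗q⁻¹) (≈ᵀ-sym ∘ A≈B)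

≈ᵀ-trans : ∀ {X Y Z} → X ≈ᵀ Y → Y ≈ᵀ Z → X ≈ᵀ Z
≈ᵀ-trans leaf≈ leaf≈ = leaf≈
≈ᵀ-trans (node≈ e₁ p₁ p⁻¹₁ A₁) (node≈ e₂ p₂ p⁻¹₂ A₂) =
  node≈ (trans e₁ e₂) (λ k → trans (p₁ k) (p₂ k)) (λ k → trans (p⁻¹₁ k) (p⁻¹₂ k)) (λ k → ≈ᵀ-trans (A₁ k) (A₂ k))

term-cong : ∀ {X Y} k → X ≈ᵀ Y → term k X ≡ term k Y
term-cong k leaf≈ = refl
term-cong {node n p p⁻¹ A} k (node≈ refl p≗q _ A≈B) =
  cong (lams n) (appsN-cong n _ (λ i _ → trans (cong (λ x → term (n ∸ suc x) (A i)) (p≗q i)) (term-cong _ (A≈B i))))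

⟦⟧-cong : ∀ {X Y} → X ≈ᵀ Y → ⟦ X ⟧ ≡ ⟦ Y ⟧
⟦⟧-cong X≈Y = cong lam (term-cong 0 X≈Y)

inv : Tree → Tree
inv leaf             = leaf
inv (node n π π⁻¹ A) = node n π⁻¹ π (λ k → inv (A (π⁻¹ k)))

WF-inv : ∀ X → WF X → WF (inv X)
WF-inv leaf             wf-leaf           = wf-leaf
WF-inv (node n π π⁻¹ A) (wf-node isA wfA) = wf-node isInv (λ k → WF-inv (A (π⁻¹ k)) (wfA (π⁻¹ k)))
  where
  open IsNode isA
  isInv : IsNode n π⁻¹ π (λ k → inv (A (π⁻¹ k)))
  isInv = record
    { positive = positive
    ; perm     = IsPermBelow-sym perm
    ; leaves   = λ k n≤k → cong inv (trans (cong A (fixed⁻¹ k n≤k)) (leaves k n≤k))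
    }

WF-⊙ : ∀ X Y → WF X → WF Y → WF (X ⊙ Y)
WF-⊙ leaf             Y                wfX               wfY               = wfY
WF-⊙ (node r p p⁻¹ A) leaf             wfX               wfY               = wfX
WF-⊙ (node r p p⁻¹ A) (node m q q⁻¹ S) (wf-node isA wfA) (wf-node isS wfS) =
  wf-node isA⊙S (λ l → WF-⊙ (S l) (A (q l)) (wfS l) (wfA (q l)))
  where
  module A = IsNode isA
  module S = IsNode isS
  r≤ = m≤m⊔n r m
  m≤ = m≤n⊔m r m
  isA⊙S : IsNode (r ⊔ m) (p ∘ q) (q⁻¹ ∘ p⁻¹) (λ l → S l ⊙ A (q l))
  isA⊙S = record
    { positive = ≤-trans A.positive r≤
    ; perm     = IsPermBelow-∘ (IsPermBelow-weaken A.perm r≤) (IsPermBelow-weaken S.perm m≤)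
    ; leaves   = λ k le → cong₂ _⊙_ (S.leaves k (≤-trans m≤ le))
                                    (trans (cong A (S.fixed k (≤-trans m≤ le))) (A.leaves k (≤-trans r≤ le)))
    }

⊙-cong : ∀ {X X′ Y Y′} → X ≈ᵀ X′ → Y ≈ᵀ Y′ → X ⊙ Y ≈ᵀ X′ ⊙ Y′
⊙-cong leaf≈ Y≈Y′ = Y≈Y′
⊙-cong (node≈ e p p⁻¹ A) leaf≈ = node≈ e p p⁻¹ A
⊙-cong {node r p p⁻¹ A} {node r′ p′ p′⁻¹ A′} {node m q q⁻¹ S} {node m′ q′ q′⁻¹ S′}
       (node≈ r≡r′ p≗p′ p⁻¹≗p′⁻¹ A≈A′) (node≈ m≡m′ q≗q′ q⁻¹≗q′⁻¹ S≈S′) =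
  node≈ (cong₂ _⊔_ r≡r′ m≡m′) (λ k → trans (cong p (q≗q′ k)) (p≗p′ (q′ k)))
        (λ k → trans (cong q⁻¹ (p⁻¹≗p′⁻¹ k)) (q⁻¹≗q′⁻¹ (p′⁻¹ k)))
        (λ l → ⊙-cong (S≈S′ l) (≈ᵀ-trans (A≈A′ (q l)) (≈ᵀ-reflexive (cong A′ (q≗q′ l)))))

inv-cong : ∀ {X Y} → X ≈ᵀ Y → inv X ≈ᵀ inv Y
inv-cong leaf≈ = leaf≈
inv-cong {node n p p⁻¹ A} {node m q q⁻¹ B} (node≈ n≡m p≗q p⁻¹≗q⁻¹ A≈B) =
  node≈ n≡m p⁻¹≗q⁻¹ p≗q (λ k → inv-cong (≈ᵀ-trans (A≈B (p⁻¹ k)) (≈ᵀ-reflexive (cong B (p⁻¹≗q⁻¹ k)))))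

⊙-assoc : ∀ X Y Z → (X ⊙ Y) ⊙ Z ≈ᵀ X ⊙ (Y ⊙ Z)
⊙-assoc leaf             Y                Z                = ≈ᵀ-refl
⊙-assoc (node r p p⁻¹ A) leaf             Z                = ≈ᵀ-refl
⊙-assoc (node r p p⁻¹ A) (node m q q⁻¹ B) leaf             = ≈ᵀ-refl
⊙-assoc (node r p p⁻¹ A) (node m q q⁻¹ B) (node o s s⁻¹ C) =
  node≈ (⊔-assoc r m o) (λ _ → refl) (λ _ → refl) (λ l → ≈ᵀ-sym (⊙-assoc (C l) (B (s l)) (A (q (s l)))))

⊙-inv-⊙ : ∀ X → WF X → X ⊙ inv X ⊙ X ≈ᵀ X
⊙-inv-⊙ leaf             _                 = leaf≈
⊙-inv-⊙ (node n π π⁻¹ A) (wf-node isA wfA) =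
  node≈ (trans (cong (_⊔ n) (⊔-idem n)) (⊔-idem n)) (cong π ∘ inverseʳ) (cong π⁻¹ ∘ inverseˡ)
        (λ l → ≈ᵀ-trans (≈ᵀ-reflexive (cong (λ k → A l ⊙ (inv (A k) ⊙ A k)) (inverseʳ l)))
                        (≈ᵀ-trans (≈ᵀ-sym (⊙-assoc (A l) (inv (A l)) (A l))) (⊙-inv-⊙ (A l) (wfA l))))
  where open IsNode isA

inv-involutive : ∀ X → WF X → inv (inv X) ≈ᵀ X
inv-involutive leaf             _                 = leaf≈
inv-involutive (node n π π⁻¹ A) (wf-node isA wfA) =
  node≈ refl (λ _ → refl) (λ _ → refl)
        (λ k → ≈ᵀ-trans (≈ᵀ-reflexive (cong (inv ∘ inv ∘ A) (inverseʳ k))) (inv-involutive (A k) (wfA k)))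
  where open IsNode isA

inv-⊙ : ∀ X Y → WF X → WF Y → inv (X ⊙ Y) ≈ᵀ inv Y ⊙ inv X
inv-⊙ leaf             Y                _                 _                 = ≈ᵀ-reflexive (sym (⊙-identityʳ (inv Y)))
inv-⊙ (node r p p⁻¹ A) leaf             _                 _                 = ≈ᵀ-refl
inv-⊙ (node r p p⁻¹ A) (node m q q⁻¹ S) (wf-node isA wfA) (wf-node isS wfS) =
  node≈ (⊔-comm r m) (λ _ → refl) (λ _ → refl)
        (λ k → ≈ᵀ-trans (≈ᵀ-reflexive (cong (λ x → inv (S (q⁻¹ (p⁻¹ k)) ⊙ A x)) (inverseˡ (p⁻¹ k))))
                        (inv-⊙ (S (q⁻¹ (p⁻¹ k))) (A (p⁻¹ k)) (wfS _) (wfA _)))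
  where open IsNode isS

data HereditaryIdentity : Tree → Set where
  leaf-id : HereditaryIdentity leaf
  node-id : ∀ {n e e⁻¹ A} → (∀ k → e k ≡ k) → (∀ k → e⁻¹ k ≡ k) → (∀ k → HereditaryIdentity (A k)) →
            HereditaryIdentity (node n e e⁻¹ A)

HereditaryIdentity-⊙-inv : ∀ X → WF X → HereditaryIdentity (X ⊙ inv X)
HereditaryIdentity-inv-⊙ : ∀ X → WF X → HereditaryIdentity (inv X ⊙ X)

HereditaryIdentity-⊙-inv leaf             _                 = leaf-id
HereditaryIdentity-⊙-inv (node n π π⁻¹ A) (wf-node isA wfA) =
  node-id inverseˡ inverseˡ (λ l → HereditaryIdentity-inv-⊙ (A (π⁻¹ l)) (wfA (π⁻¹ l)))
  where open IsNode isA

HereditaryIdentity-inv-⊙ leaf             _                 = leaf-id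
HereditaryIdentity-inv-⊙ (node n π π⁻¹ A) (wf-node isA wfA) =
  node-id inverseʳ inverseʳ
          (λ l → subst HereditaryIdentity (cong (λ k → A l ⊙ inv (A k)) (sym (inverseʳ l)))
                       (HereditaryIdentity-⊙-inv (A l) (wfA l)))
  where open IsNode isA

HereditaryIdentity-⊙-comm : ∀ E F → HereditaryIdentity E → HereditaryIdentity F → E ⊙ F ≈ᵀ F ⊙ E
HereditaryIdentity-⊙-comm leaf             F                _ _ = ≈ᵀ-reflexive (sym (⊙-identityʳ F))
HereditaryIdentity-⊙-comm (node n e e⁻¹ A) leaf             _ _ = ≈ᵀ-refl
HereditaryIdentity-⊙-comm (node n e e⁻¹ A) (node m f f⁻¹ B) (node-id e≗id e⁻¹≗id idA) (node-id f≗id f⁻¹≗id idB) =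
  node≈ (⊔-comm n m) (λ k → trans (e≗id (f k)) (trans (f≗id k) (sym (trans (f≗id (e k)) (e≗id k)))))
        (λ k → trans (f⁻¹≗id (e⁻¹ k)) (trans (e⁻¹≗id k) (sym (trans (e⁻¹≗id (f⁻¹ k)) (f⁻¹≗id k)))))
        (λ l → ≈ᵀ-trans (≈ᵀ-reflexive (cong (B l ⊙_) (cong A (f≗id l))))
               (≈ᵀ-trans (HereditaryIdentity-⊙-comm (B l) (A l) (idB l) (idA l))
                         (≈ᵀ-reflexive (cong (A l ⊙_) (cong B (sym (e≗id l)))))))

-- Hereditary permutations as trees

extendFin : ∀ {A : Set} {n} → (Fin n → A) → (ℕ → A) → ℕ → A
extendFin {n = n} f d i with i <? n
... | yes i<n = f (fromℕ< i<n)
... | no _    = d i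

extendFin-toℕ : ∀ {A : Set} {n} (f : Fin n → A) d i → extendFin f d (toℕ i) ≡ f i
extendFin-toℕ {n = n} f d i with toℕ i <? n
... | yes i<n = cong f (fromℕ<-toℕ i i<n)
... | no i≮n  = contradiction (toℕ<n i) i≮n

extendFin-≥ : ∀ {A : Set} {n} (f : Fin n → A) d k → n ≤ k → extendFin f d k ≡ d k
extendFin-≥ {n = n} f d k n≤k with k <? n
... | yes k<n = contradiction n≤k (<⇒≱ k<n)
... | no _    = refl

extendFin-all : ∀ {A : Set} {n} (P : A → Set) {f : Fin n → A} {d} → (∀ i → P (f i)) → (∀ k → P (d k)) →
                ∀ k → P (extendFin f d k)
extendFin-all {n = n} P Pf Pd k with k <? n
... | yes _ = Pf _
... | no _  = Pd k

liftFin : ∀ {n} → (Fin n → Fin n) → ℕ → ℕ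
liftFin f = extendFin (toℕ ∘ f) id

padLeaves : ∀ {n} → (Fin n → Tree) → ℕ → Tree
padLeaves A = extendFin A (λ _ → leaf)

liftFin-inverse : ∀ {n} (f g : Fin n → Fin n) → (∀ x → f (g x) ≡ x) → ∀ k → liftFin f (liftFin g k) ≡ k
liftFin-inverse {n} f g f∘g k with k <? n
... | yes k<n = trans (extendFin-toℕ (toℕ ∘ f) id (g (fromℕ< k<n))) (trans (cong toℕ (f∘g _)) (toℕ-fromℕ< k<n))
... | no k≮n  = extendFin-≥ (toℕ ∘ f) id k (≮⇒≥ k≮n)

IsPermBelow-liftFin : ∀ {n} (π : Permutation′ n) → IsPermBelow n (liftFin (π ⟨$⟩ʳ_)) (liftFin (π ⟨$⟩ˡ_))
IsPermBelow-liftFin π = record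
  { fixed    = extendFin-≥ _ id
  ; inverseˡ = liftFin-inverse _ _ (λ _ → Perm.inverseʳ π)
  ; inverseʳ = liftFin-inverse _ _ (λ _ → Perm.inverseˡ π)
  }

toPermutation : ∀ {n f g} → IsPermBelow n f g → Permutation′ n
toPermutation {f = f} {g} π = permutation f′ g′
  (λ i → toℕ-injective (trans (toℕ-fromℕ< _) (trans (cong f (toℕ-fromℕ< _)) (inverseˡ (toℕ i)))))
  (λ i → toℕ-injective (trans (toℕ-fromℕ< _) (trans (cong g (toℕ-fromℕ< _)) (inverseʳ (toℕ i)))))
  where
  open IsPermBelow π
  f′ g′ : Fin _ → Fin _
  f′ i = fromℕ< (<n (toℕ i) (toℕ<n i))
  g′ i = fromℕ< (<n⁻¹ (toℕ i) (toℕ<n i))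

toℕ-toPermutation : ∀ {n f g} (π : IsPermBelow n f g) i → toℕ (toPermutation π ⟨$⟩ʳ i) ≡ f (toℕ i)
toℕ-toPermutation π i = toℕ-fromℕ< _

fromHP : ∀ {k T} → HP k T → Tree
fromHP (hp zero    π ts h) = leaf
fromHP (hp (suc n) π ts h) = node (suc n) (liftFin (π ⟨$⟩ʳ_)) (liftFin (π ⟨$⟩ˡ_)) (padLeaves (λ i → fromHP (h i)))

WF-fromHP : ∀ {k T} (h : HP k T) → WF (fromHP h)
WF-fromHP (hp zero    π ts h) = wf-leaf
WF-fromHP (hp (suc n) π ts h) =
  wf-node (record { positive = s≤s z≤n ; perm = IsPermBelow-liftFin π ; leaves = extendFin-≥ _ _ })
          (extendFin-all WF (λ i → WF-fromHP (h i)) (λ _ → wf-leaf))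

apps-cong : ∀ {n} h {ts ts′ : Fin n → Term} → (∀ i → ts i ≡ ts′ i) → apps h ts ≡ apps h ts′
apps-cong {zero}  h e = refl
apps-cong {suc n} h e rewrite e fzero = apps-cong _ (e ∘ fsuc)

term-fromHP : ∀ {k T} (h : HP k T) → T ≡ term k (fromHP h)
term-fromHP (hp zero    π ts h) = refl
term-fromHP (hp (suc n) π ts h) =
  cong (lams (suc n)) (trans (apps-cong _ child) (apps≡appsN (suc n) _ (children (suc n) πℕ A)))
  where
  πℕ = liftFin (π ⟨$⟩ʳ_)
  A  = padLeaves (λ i → fromHP (h i))
  child : ∀ i → ts i ≡ children (suc n) πℕ A (toℕ i)
  child i = trans (term-fromHP (h i))
                  (cong₂ (λ x → term (suc n ∸ suc x)) (sym (extendFin-toℕ _ id i)) (sym (extendFin-toℕ _ _ i)))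

toHP : ∀ X k → WF X → HP k (term k X)
toHP leaf                   k _ = hp 0 Perm.id (λ ()) (λ ())
toHP (node zero π π⁻¹ A)    k (wf-node isA _) with IsNode.positive isA
... | ()
toHP (node (suc n) π π⁻¹ A) k (wf-node isA wfA) =
  subst (HP k) (cong (lams N) (apps≡appsN N _ (children N π A))) (hp N σ (children N π A ∘ toℕ) child)
  where
  N = suc n
  σ = toPermutation (IsNode.perm isA)
  child : ∀ i → HP (N ∸ suc (toℕ (σ ⟨$⟩ʳ i))) (children N π A (toℕ i))
  child i = subst (λ j → HP j (children N π A (toℕ i)))
                  (cong (λ x → N ∸ suc x) (sym (toℕ-toPermutation (IsNode.perm isA) i)))
                  (toHP (A (toℕ i)) _ (wfA (toℕ i)))

-- η-equivalence and η-normal forms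

arity : Tree → ℕ
arity leaf             = 0
arity (node n _ _ _)   = n

-- A leaf behaves as a node of any arity with identity pointers and leaf subtrees, i.e. as the
-- η-expansions of the bare variable; pointerAt and subtreeAt read trees modulo η-expansion.
pointerAt : Tree → ℕ → ℕ
pointerAt leaf             = id
pointerAt (node _ π _ _)   = π

subtreeAt : Tree → ℕ → Tree
subtreeAt leaf             _ = leaf
subtreeAt (node _ _ _ A)   = A

infix 4 _≈η_
data _≈η_ : Tree → Tree → Set where
  leaf≈η : leaf ≈η leaf
  node≈η : ∀ {X Y} → (∀ k → pointerAt X k ≡ pointerAt Y k) → (∀ k → subtreeAt X k ≈η subtreeAt Y k) → X ≈η Y

pointerAt-≈η : ∀ {X Y} → X ≈η Y → ∀ k → pointerAt X k ≡ pointerAt Y k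
pointerAt-≈η leaf≈η       k = refl
pointerAt-≈η (node≈η p _) = p

subtreeAt-≈η : ∀ {X Y} → X ≈η Y → ∀ k → subtreeAt X k ≈η subtreeAt Y k
subtreeAt-≈η leaf≈η       k = leaf≈η
subtreeAt-≈η (node≈η _ A) = A

≈η-refl : ∀ {X} → X ≈η X
≈η-refl {leaf}           = leaf≈η
≈η-refl {node n π π⁻¹ A} = node≈η (λ _ → refl) (λ k → ≈η-refl {A k})

≈η-reflexive : ∀ {X Y} → X ≡ Y → X ≈η Y
≈η-reflexive refl = ≈η-refl

≈η-sym : ∀ {X Y} → X ≈η Y → Y ≈η X
≈η-sym leaf≈η       = leaf≈η
≈η-sym (node≈η p A) = node≈η (sym ∘ p) (≈η-sym ∘ A)

≈η-trans : ∀ {X Y Z} → X ≈η Y → Y ≈η Z → X ≈η Z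
≈η-trans leaf≈η       Y≈Z = Y≈Z
≈η-trans (node≈η p A) Y≈Z = node≈η (λ k → trans (p k) (pointerAt-≈η Y≈Z k)) (λ k → ≈η-trans (A k) (subtreeAt-≈η Y≈Z k))

data Apart : Tree → Tree → Set where
  pointer-apart : ∀ {X Y} k → pointerAt X k ≢ pointerAt Y k → Apart X Y
  subtree-apart : ∀ {X Y} k → Apart (subtreeAt X k) (subtreeAt Y k) → Apart X Y

pointerAt-≥ : ∀ {X} → WF X → ∀ k → arity X ≤ k → pointerAt X k ≡ k
pointerAt-≥ wf-leaf         k _ = refl
pointerAt-≥ (wf-node isA _) k   = IsNode.fixed isA k

subtreeAt-≥ : ∀ {X} → WF X → ∀ k → arity X ≤ k → subtreeAt X k ≡ leaf
subtreeAt-≥ wf-leaf         k _ = refl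
subtreeAt-≥ (wf-node isA _) k   = IsNode.leaves isA k

WF-subtreeAt : ∀ {X} → WF X → ∀ k → WF (subtreeAt X k)
WF-subtreeAt wf-leaf         k = wf-leaf
WF-subtreeAt (wf-node _ wfA) k = wfA k

all<-or : ∀ N {P : ℕ → Set} {Q : Set} → (∀ k → k < N → P k ⊎ Q) → (∀ k → k < N → P k) ⊎ Q
all<-or zero    d = inj₁ (λ _ ())
all<-or (suc N) {P} d with d 0 z<s | all<-or N {P ∘ suc} (λ k k<N → d (suc k) (s≤s k<N))
... | inj₂ q  | _       = inj₂ q
... | inj₁ _  | inj₂ q  = inj₂ q
... | inj₁ p0 | inj₁ ps = inj₁ (λ { zero _ → p0 ; (suc k) (s≤s k<N) → ps k k<N })

≈η-or-Apart-node : ∀ {X Y} → WF X → WF Y → (∀ k → subtreeAt X k ≈η subtreeAt Y k ⊎ Apart (subtreeAt X k) (subtreeAt Y k)) →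
                   X ≈η Y ⊎ Apart X Y
≈η-or-Apart-node {X} {Y} wfX wfY subtrees with all<-or (arity X ⊔ arity Y) position
  where
  position : ∀ k → k < arity X ⊔ arity Y →
             (pointerAt X k ≡ pointerAt Y k × subtreeAt X k ≈η subtreeAt Y k) ⊎ Apart X Y
  position k _ with pointerAt X k ≟ pointerAt Y k | subtrees k
  ... | no ≢   | _        = inj₂ (pointer-apart k ≢)
  ... | yes _  | inj₂ a   = inj₂ (subtree-apart k a)
  ... | yes ≡p | inj₁ ≈A  = inj₁ (≡p , ≈A)
... | inj₂ a   = inj₂ a
... | inj₁ all = inj₁ (node≈η same-pointer same-subtree)
  where
  beyond : ∀ {k} → ¬ k < arity X ⊔ arity Y → arity X ≤ k × arity Y ≤ k
  beyond k≮ = ≤-trans (m≤m⊔n _ _) (≮⇒≥ k≮) , ≤-trans (m≤n⊔m _ _) (≮⇒≥ k≮)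
  same-pointer : ∀ k → pointerAt X k ≡ pointerAt Y k
  same-pointer k with k <? arity X ⊔ arity Y
  ... | yes k< = proj₁ (all k k<)
  ... | no k≮  = trans (pointerAt-≥ wfX k (proj₁ (beyond k≮))) (sym (pointerAt-≥ wfY k (proj₂ (beyond k≮))))
  same-subtree : ∀ k → subtreeAt X k ≈η subtreeAt Y k
  same-subtree k with k <? arity X ⊔ arity Y
  ... | yes k< = proj₂ (all k k<)
  ... | no k≮  = ≈η-reflexive (trans (subtreeAt-≥ wfX k (proj₁ (beyond k≮))) (sym (subtreeAt-≥ wfY k (proj₂ (beyond k≮)))))

≈η-or-Apart : ∀ X Y → WF X → WF Y → X ≈η Y ⊎ Apart X Y
≈η-or-Apart leaf leaf _ _ = inj₁ leaf≈η
≈η-or-Apart leaf (node m q q⁻¹ B) wfX (wf-node isB wfB) =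
  ≈η-or-Apart-node wfX (wf-node isB wfB) (λ k → ≈η-or-Apart leaf (B k) wf-leaf (wfB k))
≈η-or-Apart (node n p p⁻¹ A) leaf (wf-node isA wfA) wfY =
  ≈η-or-Apart-node (wf-node isA wfA) wfY (λ k → ≈η-or-Apart (A k) leaf (wfA k) wf-leaf)
≈η-or-Apart (node n p p⁻¹ A) (node m q q⁻¹ B) (wf-node isA wfA) (wf-node isB wfB) =
  ≈η-or-Apart-node (wf-node isA wfA) (wf-node isB wfB) (λ k → ≈η-or-Apart (A k) (B k) (wfA k) (wfB k))

leaf? : ∀ X → Dec (X ≡ leaf)
leaf? leaf             = yes refl
leaf? (node _ _ _ _)   = no (λ ())

Redundant : (ℕ → ℕ) → (ℕ → Tree) → ℕ → Set
Redundant p A k = p k ≡ k × A k ≡ leaf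

-- The arity left after dropping the trailing arguments that are η-expansion variables.
essentialArity : ℕ → (ℕ → ℕ) → (ℕ → Tree) → ℕ
essentialArity zero    p A = zero
essentialArity (suc n) p A with p n ≟ n | leaf? (A n)
... | yes _ | yes _ = essentialArity n p A
... | _     | _     = suc n

essentialArity-redundant : ∀ n p A k → essentialArity n p A ≤ k → k < n → Redundant p A k
essentialArity-redundant (suc n) p A k le k<1+n with p n ≟ n | leaf? (A n)
... | no _    | _       = contradiction le (<⇒≱ k<1+n)
... | yes _   | no _    = contradiction le (<⇒≱ k<1+n)
... | yes pn≡n | yes An≡leaf with k <? n
...   | yes k<n = essentialArity-redundant n p A k le k<n
...   | no k≮n rewrite ≤-antisym (s≤s⁻¹ k<1+n) (≮⇒≥ k≮n) = pn≡n , An≡leaf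

essentialArity-last : ∀ n p A t → essentialArity n p A ≡ suc t → ¬ Redundant p A t
essentialArity-last (suc n) p A t e with p n ≟ n | leaf? (A n)
essentialArity-last (suc n) p A t  e    | yes _ | yes _ = essentialArity-last n p A t e
essentialArity-last (suc n) p A .n refl | yes _ | no A≢leaf = A≢leaf ∘ proj₂
essentialArity-last (suc n) p A .n refl | no p≢n | _        = p≢n ∘ proj₁

nodeOrLeaf : ℕ → (ℕ → ℕ) → (ℕ → ℕ) → (ℕ → Tree) → Tree
nodeOrLeaf zero    _ _   _ = leaf
nodeOrLeaf (suc t) π π⁻¹ A = node (suc t) π π⁻¹ A

ηnf : Tree → Tree
ηnf leaf             = leaf
ηnf (node n π π⁻¹ A) = nodeOrLeaf (essentialArity n π (λ k → ηnf (A k))) π π⁻¹ (λ k → ηnf (A k))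

data ηNormal : Tree → Set where
  leaf-η : ηNormal leaf
  node-η : ∀ {t π π⁻¹ A} → ¬ Redundant π A t → (∀ k → ηNormal (A k)) → ηNormal (node (suc t) π π⁻¹ A)

ηNormal-ηnf : ∀ X → ηNormal (ηnf X)
ηNormal-ηnf leaf             = leaf-η
ηNormal-ηnf (node n π π⁻¹ A) with essentialArity n π (λ k → ηnf (A k)) in eq
... | zero  = leaf-η
... | suc t = node-η (essentialArity-last n π _ t eq) (λ k → ηNormal-ηnf (A k))

redundant-beyond-essentialArity : ∀ {n π π⁻¹ A} → IsNode n π π⁻¹ A →
                                  ∀ k → essentialArity n π (λ k → ηnf (A k)) ≤ k → Redundant π (λ k → ηnf (A k)) k
redundant-beyond-essentialArity {n} {π} isA k le with k <? n
... | yes k<n = essentialArity-redundant n π _ k le k<n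
... | no k≮n  = IsNode.fixed isA k (≮⇒≥ k≮n) , cong ηnf (IsNode.leaves isA k (≮⇒≥ k≮n))

≈η-ηnf : ∀ X → WF X → X ≈η ηnf X
≈η-ηnf leaf             _                 = leaf≈η
≈η-ηnf (node n π π⁻¹ A) (wf-node isA wfA) with essentialArity n π (λ k → ηnf (A k)) in eq
... | zero  = node≈η (λ k → proj₁ (redundant k)) (λ k → ≈η-trans (≈η-ηnf (A k) (wfA k)) (≈η-reflexive (proj₂ (redundant k))))
  where redundant = λ k → redundant-beyond-essentialArity isA k (subst (_≤ k) (sym eq) z≤n)
... | suc t = node≈η (λ _ → refl) (λ k → ≈η-ηnf (A k) (wfA k))

WF-ηnf : ∀ X → WF X → WF (ηnf X)
WF-ηnf leaf             _                 = wf-leaf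
WF-ηnf (node n π π⁻¹ A) (wf-node isA wfA) with essentialArity n π (λ k → ηnf (A k)) in eq
... | zero  = wf-leaf
... | suc t = wf-node isNode (λ k → WF-ηnf (A k) (wfA k))
  where
  open IsNode isA
  redundant = λ k (le : suc t ≤ k) → redundant-beyond-essentialArity isA k (subst (_≤ k) (sym eq) le)
  isNode : IsNode (suc t) π π⁻¹ (λ k → ηnf (A k))
  isNode = record
    { positive = s≤s z≤n
    ; perm     = record { fixed = λ k le → proj₁ (redundant k le) ; inverseˡ = inverseˡ ; inverseʳ = inverseʳ }
    ; leaves   = λ k le → proj₂ (redundant k le)
    }

ηNormal-≈η-leaf : ∀ {Y} → ηNormal Y → Y ≈η leaf → Y ≡ leaf
ηNormal-≈η-leaf leaf-η                 _      = refl
ηNormal-≈η-leaf (node-η {t} last ηA) Y≈leaf =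
  contradiction (pointerAt-≈η Y≈leaf t , ηNormal-≈η-leaf (ηA t) (subtreeAt-≈η Y≈leaf t)) last

arity-ηNormal-≤ : ∀ {X Z} → WF X → ηNormal Z → X ≈η Z → arity Z ≤ arity X
arity-ηNormal-≤ {X} wfX leaf-η                  _   = z≤n
arity-ηNormal-≤ {X} wfX (node-η {t} last ηA) X≈Z with suc t ≤? arity X
... | yes le = le
... | no t≥ = contradiction
  (trans (sym (pointerAt-≈η X≈Z t)) (pointerAt-≥ wfX t X≤t) ,
   ηNormal-≈η-leaf (ηA t) (≈η-trans (≈η-sym (subtreeAt-≈η X≈Z t)) (≈η-reflexive (subtreeAt-≥ wfX t X≤t))))
  last
  where X≤t = s≤s⁻¹ (≰⇒> t≥)

⊙-inv-≈η-leaf : ∀ X → WF X → X ≈η leaf → X ⊙ inv X ≈ᵀ X × inv X ⊙ X ≈ᵀ X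
⊙-inv-≈η-leaf leaf             _                 _      = leaf≈ , leaf≈
⊙-inv-≈η-leaf (node m x x⁻¹ B) (wf-node isX wfB) X≈leaf =
  node≈ (⊔-idem m) (λ l → trans (inverseˡ l) (sym (x≗id l))) (λ l → trans (inverseˡ l) (sym (x⁻¹≗id l)))
        (λ l → ≈ᵀ-trans (≈ᵀ-reflexive (cong (λ k → inv (B k) ⊙ B k) (x⁻¹≗id l))) (proj₂ (below l))) ,
  node≈ (⊔-idem m) (λ l → trans (inverseʳ l) (sym (x≗id l))) (λ l → trans (inverseʳ l) (sym (x⁻¹≗id l)))
        (λ l → ≈ᵀ-trans (≈ᵀ-reflexive (cong (λ k → B l ⊙ inv (B k)) (inverseʳ l))) (proj₁ (below l)))
  where
  open IsNode isX
  x≗id : ∀ l → x l ≡ l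
  x≗id = pointerAt-≈η X≈leaf
  x⁻¹≗id : ∀ l → x⁻¹ l ≡ l
  x⁻¹≗id = inverse-≗ inverseʳ (λ _ → refl) x≗id
  below = λ l → ⊙-inv-≈η-leaf (B l) (wfB l) (subtreeAt-≈η X≈leaf l)

ηNormal≢leaf : ∀ {X Z} → ηNormal Z → X ≈η Z → X ≡ leaf → Z ≡ leaf
ηNormal≢leaf ηZ X≈Z refl = ηNormal-≈η-leaf ηZ (≈η-sym X≈Z)

-- A tree η-equivalent to an η-normal Z is a restriction of Z (lies below Z in the natural order).
⊙-inv-⊙-ηNormalˡ : ∀ X Z → WF X → WF Z → ηNormal Z → X ≈η Z → X ⊙ inv X ⊙ Z ≈ᵀ X
⊙-inv-⊙-ηNormalʳ : ∀ X Z → WF X → WF Z → ηNormal Z → X ≈η Z → Z ⊙ (inv X ⊙ X) ≈ᵀ X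

⊙-inv-⊙-ηNormalˡ leaf leaf _ _ _ _ = leaf≈
⊙-inv-⊙-ηNormalˡ leaf (node _ _ _ _) _ _ ηZ X≈Z with () ← ηNormal≢leaf ηZ X≈Z refl
⊙-inv-⊙-ηNormalˡ (node m x x⁻¹ B) leaf wfX _ _ X≈Z = proj₁ (⊙-inv-≈η-leaf _ wfX X≈Z)
⊙-inv-⊙-ηNormalˡ (node m x x⁻¹ B) (node n p p⁻¹ A) (wf-node isX wfB) (wf-node isZ wfA) ηZ@(node-η _ ηA) X≈Z =
  node≈ (trans (cong (_⊔ n) (⊔-idem m)) (m≥n⇒m⊔n≡m n≤m)) (λ l → trans (X.inverseˡ (p l)) (sym (x≗p l)))
        (λ l → trans (cong p⁻¹ (X.inverseˡ l)) (sym (x⁻¹≗p⁻¹ l)))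
        (λ l → ≈ᵀ-trans (≈ᵀ-reflexive (cong (λ k → A l ⊙ (inv (B k) ⊙ B k)) (trans (cong x⁻¹ (sym (x≗p l))) (X.inverseʳ l))))
                        (⊙-inv-⊙-ηNormalʳ (B l) (A l) (wfB l) (wfA l) (ηA l) (subtreeAt-≈η X≈Z l)))
  where
  module X = IsNode isX
  module Z = IsNode isZ
  x≗p = pointerAt-≈η X≈Z
  x⁻¹≗p⁻¹ : ∀ l → x⁻¹ l ≡ p⁻¹ l
  x⁻¹≗p⁻¹ = inverse-≗ X.inverseʳ Z.inverseˡ x≗p
  n≤m = arity-ηNormal-≤ (wf-node isX wfB) ηZ X≈Z

⊙-inv-⊙-ηNormalʳ leaf leaf _ _ _ _ = leaf≈
⊙-inv-⊙-ηNormalʳ leaf (node _ _ _ _) _ _ ηZ X≈Z with () ← ηNormal≢leaf ηZ X≈Z refl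
⊙-inv-⊙-ηNormalʳ (node m x x⁻¹ B) leaf wfX _ _ X≈Z = proj₂ (⊙-inv-≈η-leaf _ wfX X≈Z)
⊙-inv-⊙-ηNormalʳ (node m x x⁻¹ B) (node n p p⁻¹ A) (wf-node isX wfB) (wf-node isZ wfA) ηZ@(node-η _ ηA) X≈Z =
  node≈ (trans (cong (n ⊔_) (⊔-idem m)) (m≤n⇒m⊔n≡n n≤m)) (λ l → trans (cong p (X.inverseʳ l)) (sym (x≗p l)))
        (λ l → trans (X.inverseʳ (p⁻¹ l)) (sym (x⁻¹≗p⁻¹ l)))
        (λ l → ≈ᵀ-trans (≈ᵀ-reflexive (cong (λ k → B l ⊙ inv (B k) ⊙ A k) (X.inverseʳ l)))
                        (⊙-inv-⊙-ηNormalˡ (B l) (A l) (wfB l) (wfA l) (ηA l) (subtreeAt-≈η X≈Z l)))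
  where
  module X = IsNode isX
  module Z = IsNode isZ
  x≗p = pointerAt-≈η X≈Z
  x⁻¹≗p⁻¹ : ∀ l → x⁻¹ l ≡ p⁻¹ l
  x⁻¹≗p⁻¹ = inverse-≗ X.inverseʳ Z.inverseˡ x≗p
  n≤m = arity-ηNormal-≤ (wf-node isX wfB) ηZ X≈Z

HereditaryIdentity-≈η-leaf : ∀ {E} → HereditaryIdentity E → E ≈η leaf
HereditaryIdentity-≈η-leaf leaf-id               = leaf≈η
HereditaryIdentity-≈η-leaf (node-id e≗id _ idA) = node≈η e≗id (HereditaryIdentity-≈η-leaf ∘ idA)

HereditaryIdentity-⊙ˡ-≈η : ∀ E X → HereditaryIdentity E → E ⊙ X ≈η X
HereditaryIdentity-⊙ʳ-≈η : ∀ X E → HereditaryIdentity E → X ⊙ E ≈η X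

HereditaryIdentity-⊙ˡ-≈η leaf             X                _  = ≈η-refl
HereditaryIdentity-⊙ˡ-≈η (node n e e⁻¹ A) leaf             idE = HereditaryIdentity-≈η-leaf idE
HereditaryIdentity-⊙ˡ-≈η (node n e e⁻¹ A) (node m x x⁻¹ B) (node-id e≗id _ idA) =
  node≈η (e≗id ∘ x) (λ k → HereditaryIdentity-⊙ʳ-≈η (B k) (A (x k)) (idA (x k)))

HereditaryIdentity-⊙ʳ-≈η leaf             E                idE = HereditaryIdentity-≈η-leaf idE
HereditaryIdentity-⊙ʳ-≈η (node m x x⁻¹ B) leaf             _   = ≈η-refl
HereditaryIdentity-⊙ʳ-≈η (node m x x⁻¹ B) (node n e e⁻¹ A) (node-id e≗id _ idA) =
  node≈η (cong x ∘ e≗id)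
         (λ k → ≈η-trans (≈η-reflexive (cong (λ j → A k ⊙ B j) (e≗id k))) (HereditaryIdentity-⊙ˡ-≈η (A k) (B k) (idA k)))

-- Böhm-out

appsN-plug⟶* : ∀ X W R cs → WF X → Closed W → arity X ≤ R →
               appsN R (plug X W) cs ⟶* appsN R W (λ i → plug (subtreeAt X i) (cs (pointerAt X i)))
appsN-plug⟶* leaf             W R cs _                 _      _   = ε
appsN-plug⟶* (node r π π⁻¹ A) W R cs (wf-node isA wfA) closed r≤R with m≤n⇒∃[o]m+o≡n r≤R
... | d , refl = begin
  appsN (r + d) (lams r (appsN r (ren (r +_) W) (children r π A))) cs
    ≡⟨ appsN-+ r d _ cs ⟩
  appsN d (appsN r (lams r (appsN r (ren (r +_) W) (children r π A))) cs) (cs ∘ (r +_))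
    ⟶*⟨ appsN⟶*ˡ d _ (β-appsN-lams r _ cs) ⟩
  appsN d (sub (args r cs) (appsN r (ren (r +_) W) (children r π A))) (cs ∘ (r +_))
    ≡⟨ cong (λ t → appsN d t (cs ∘ (r +_))) substituted ⟩
  appsN d (appsN r W (λ i → plug (A i) (cs (π i)))) (cs ∘ (r +_))
    ≡⟨ appsN-cong d _ unused ⟩
  appsN d (appsN r W (λ i → plug (A i) (cs (π i)))) (λ k → plug (A (r + k)) (cs (π (r + k))))
    ≡⟨ appsN-+ r d W _ ⟨
  appsN (r + d) W (λ i → plug (A i) (cs (π i)))
    ∎
  where
  open StarReasoning _⟶β_
  open IsNode isA
  child : ∀ i → i < r → sub (args r cs) (children r π A i) ≡ plug (A i) (cs (π i))
  child i i<r = trans (sub-term (A i) (args r cs) _ (wfA i)) (cong (plug (A i)) (args-< r cs (π i) (<n i i<r)))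
  substituted : sub (args r cs) (appsN r (ren (r +_) W) (children r π A)) ≡ appsN r W (λ i → plug (A i) (cs (π i)))
  substituted = trans (sub-appsN (args r cs) r _ _)
                      (trans (cong (λ h → appsN r h (sub (args r cs) ∘ children r π A)) (trans (cong (sub _) (Closed-ren closed (r +_))) (closed _)))
                             (appsN-cong r W child))
  unused : ∀ k → k < d → cs (r + k) ≡ plug (A (r + k)) (cs (π (r + k)))
  unused k _ rewrite leaves (r + k) (m≤m+n r k) | fixed (r + k) (m≤m+n r k) = refl

Closed-lams : ∀ Q {M} → Closed M → Closed (lams Q M)
Closed-lams Q {M} closed σ = trans (sub-lams Q σ M) (cong (lams Q) (closed _))

appsN-lams-closed⟶* : ∀ Q M ds → Closed M → appsN Q (lams Q M) ds ⟶* M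
appsN-lams-closed⟶* Q M ds closed = β-appsN-lams Q M ds ◅◅ ≡⇒⟶* (closed _)

projection : ℕ → ℕ → Term
projection R k = lams R (var (R ∸ suc k))

Closed-projection : ∀ R k → k < R → Closed (projection R k)
Closed-projection R k k<R σ = trans (sub-lams R σ _) (cong (lams R) (exts^-< R σ _ (∸-suc-< k<R)))

appsN-projection⟶* : ∀ R k ds → k < R → appsN R (projection R k) ds ⟶* ds k
appsN-projection⟶* R k ds k<R = β-appsN-lams R _ ds ◅◅ ≡⇒⟶* (args-< R ds k k<R)

select-subtree : ∀ Z k R cs → WF Z → arity Z ≤ R → k < R →
                 appsN R (plug Z (projection R k)) cs ⟶* plug (subtreeAt Z k) (cs (pointerAt Z k))
select-subtree Z k R cs wfZ Z≤R k<R = appsN-plug⟶* Z (projection R k) R cs wfZ (Closed-projection R k k<R) Z≤R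
                                      ◅◅ appsN-projection⟶* R k _ k<R

𝐓 𝐅 : Term
𝐓 = lam (lam (var 1))
𝐅 = lam (lam (var 0))

record Separation (X Y : Tree) : Set where
  field
    head      : Term
    arguments : List Term
    left      : foldl app (plug X head) arguments ⟶* 𝐓
    right     : foldl app (plug Y head) arguments ⟶* 𝐅

-- With head projecting onto argument k, both trees move to their k-th subtree, which receives
-- the argument at its pointer; these arguments are chosen to tell the two trees apart.
module _ {X Y : Tree} (k : ℕ) (wfX : WF X) (wfY : WF Y) where
  private
    R = suc ((arity X ⊔ arity Y) ⊔ k)
    k<R : k < R
    k<R = s≤s (m≤n⊔m _ k)
    X≤R : arity X ≤ R
    X≤R = m≤n⇒m≤1+n (≤-trans (m≤m⊔n (arity X) (arity Y)) (m≤m⊔n _ k))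
    Y≤R : arity Y ≤ R
    Y≤R = m≤n⇒m≤1+n (≤-trans (m≤n⊔m (arity X) (arity Y)) (m≤m⊔n _ k))
    a = pointerAt X k
    b = pointerAt Y k

    select-then : ∀ Z cs ys {M} → WF Z → arity Z ≤ R → foldl app (plug (subtreeAt Z k) (cs (pointerAt Z k))) ys ⟶* M →
                  foldl app (plug Z (projection R k)) (applyUpTo cs R ++ ys) ⟶* M
    select-then Z cs ys wfZ Z≤R continue =
      ≡⇒⟶* (foldl-++ app _ (applyUpTo cs R) ys) ◅◅ foldl-app⟶*ˡ ys (select-subtree Z k R cs wfZ Z≤R k<R) ◅◅ continue

  separate-pointer : a ≢ b → Separation X Y
  separate-pointer a≢b = record
    { head      = projection R k
    ; arguments = applyUpTo cs R ++ applyUpTo (λ _ → 𝐈) Q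
    ; left      = select-then X cs _ wfX X≤R (finish X wfX 𝐓 (λ _ → refl) (m≤m⊔n _ _) cs-a)
    ; right     = select-then Y cs _ wfY Y≤R (finish Y wfY 𝐅 (λ _ → refl) (m≤n⊔m _ _) cs-b)
    }
    where
    Q = arity (subtreeAt X k) ⊔ arity (subtreeAt Y k)
    cs : ℕ → Term
    cs i with i ≟ a | i ≟ b
    ... | yes _ | _     = lams Q 𝐓
    ... | no _  | yes _ = lams Q 𝐅
    ... | no _  | no _  = 𝐈
    cs-a : cs a ≡ lams Q 𝐓
    cs-a with a ≟ a | a ≟ b
    ... | yes _ | _    = refl
    ... | no a≢a | _   = contradiction refl a≢a
    cs-b : cs b ≡ lams Q 𝐅
    cs-b with b ≟ a | b ≟ b
    ... | yes b≡a | _      = contradiction (sym b≡a) a≢b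
    ... | no _    | yes _  = refl
    ... | no _    | no b≢b = contradiction refl b≢b
    finish : ∀ Z → WF Z → ∀ M → Closed M → arity (subtreeAt Z k) ≤ Q → cs (pointerAt Z k) ≡ lams Q M →
             foldl app (plug (subtreeAt Z k) (cs (pointerAt Z k))) (applyUpTo (λ _ → 𝐈) Q) ⟶* M
    finish Z wfZ M closed ≤Q cs≡ rewrite cs≡ =
      appsN-plug⟶* (subtreeAt Z k) (lams Q M) Q _ (WF-subtreeAt wfZ k) (Closed-lams Q closed) ≤Q
      ◅◅ appsN-lams-closed⟶* Q M _ closed

  separate-subtree : a ≡ b → Separation (subtreeAt X k) (subtreeAt Y k) → Separation X Y
  separate-subtree a≡b S = record
    { head      = projection R k
    ; arguments = applyUpTo cs R ++ S.arguments
    ; left      = select-then X cs _ wfX X≤R (subst (λ t → foldl app (plug (subtreeAt X k) t) S.arguments ⟶* 𝐓) (sym (cs-head refl)) S.left)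
    ; right     = select-then Y cs _ wfY Y≤R (subst (λ t → foldl app (plug (subtreeAt Y k) t) S.arguments ⟶* 𝐅) (sym (cs-head a≡b)) S.right)
    }
    where
    module S = Separation S
    cs : ℕ → Term
    cs i with i ≟ a
    ... | yes _ = S.head
    ... | no _  = 𝐈
    cs-head : ∀ {i} → a ≡ i → cs i ≡ S.head
    cs-head {i} a≡i with i ≟ a
    ... | yes _   = refl
    ... | no i≢a  = contradiction (sym a≡i) i≢a

separate : ∀ {X Y} → WF X → WF Y → Apart X Y → Separation X Y
separate wfX wfY (pointer-apart k a≢b) = separate-pointer k wfX wfY a≢b
separate {X} {Y} wfX wfY (subtree-apart k apart) with pointerAt X k ≟ pointerAt Y k
... | no a≢b  = separate-pointer k wfX wfY a≢b
... | yes a≡b = separate-subtree k wfX wfY a≡b (separate (WF-subtreeAt wfX k) (WF-subtreeAt wfY k) apart)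

-- Inverse semigroups

module InverseSemigroup {c ℓ} (S : Semigroup c ℓ) where
  open Semigroup S renaming (sym to ≈-sym; trans to ≈-trans; setoid to ≈-setoid)

  module Properties
    (_⁻¹ : Carrier → Carrier)
    (regular          : ∀ x → x ∙ x ⁻¹ ∙ x ≈ x)
    (⁻¹-involutive    : ∀ x → (x ⁻¹) ⁻¹ ≈ x)
    (idempotents-comm : ∀ x y → (x ∙ x ⁻¹) ∙ (y ∙ y ⁻¹) ≈ (y ∙ y ⁻¹) ∙ (x ∙ x ⁻¹))
    where

    open SetoidReasoning ≈-setoid

    infix 4 _≤ₙ_
    _≤ₙ_ : Carrier → Carrier → Set ℓ
    x ≤ₙ y = x ∙ x ⁻¹ ∙ y ≈ x

    ≤ₙ-antisym : ∀ {x y} → x ≤ₙ y → y ≤ₙ x → x ≈ y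
    ≤ₙ-antisym {x} {y} x≤y y≤x = ≈-sym (begin
      y                                 ≈⟨ y≤x ⟨
      (y ∙ y ⁻¹) ∙ x                    ≈⟨ ∙-congˡ x≤y ⟨
      (y ∙ y ⁻¹) ∙ ((x ∙ x ⁻¹) ∙ y)     ≈⟨ assoc _ _ y ⟨
      (y ∙ y ⁻¹) ∙ (x ∙ x ⁻¹) ∙ y       ≈⟨ ∙-congʳ (idempotents-comm y x) ⟩
      (x ∙ x ⁻¹) ∙ (y ∙ y ⁻¹) ∙ y       ≈⟨ assoc _ _ y ⟩
      (x ∙ x ⁻¹) ∙ ((y ∙ y ⁻¹) ∙ y)     ≈⟨ ∙-congˡ (regular y) ⟩
      (x ∙ x ⁻¹) ∙ y                    ≈⟨ x≤y ⟩
      x                                 ∎)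

    inverse-unique : ∀ {x b c} → x ∙ b ∙ x ≈ x → b ∙ x ∙ b ≈ b → x ∙ c ∙ x ≈ x → c ∙ x ∙ c ≈ c →
                     (b ∙ x) ∙ (c ∙ x) ≈ (c ∙ x) ∙ (b ∙ x) → (x ∙ b) ∙ (x ∙ c) ≈ (x ∙ c) ∙ (x ∙ b) → b ≈ c
    inverse-unique {x} {b} {c} xbx bxb xcx cxc bx-cx xb-xc = ≈-trans b≈cxb (≈-sym c≈cxb)
      where
      b≈cxb : b ≈ c ∙ x ∙ b
      b≈cxb = begin
        b                           ≈⟨ bxb ⟨
        b ∙ x ∙ b                   ≈⟨ ∙-congʳ (∙-congˡ xcx) ⟨
        b ∙ (x ∙ c ∙ x) ∙ b         ≈⟨ ∙-congʳ (≈-trans (∙-congˡ (assoc x c x)) (≈-sym (assoc b x (c ∙ x)))) ⟩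
        (b ∙ x) ∙ (c ∙ x) ∙ b       ≈⟨ ∙-congʳ bx-cx ⟩
        (c ∙ x) ∙ (b ∙ x) ∙ b       ≈⟨ assoc (c ∙ x) (b ∙ x) b ⟩
        (c ∙ x) ∙ (b ∙ x ∙ b)       ≈⟨ ∙-congˡ bxb ⟩
        c ∙ x ∙ b                   ∎
      c≈cxb : c ≈ c ∙ x ∙ b
      c≈cxb = begin
        c                           ≈⟨ cxc ⟨
        c ∙ x ∙ c                   ≈⟨ assoc c x c ⟩
        c ∙ (x ∙ c)                 ≈⟨ ∙-congˡ (∙-congʳ xbx) ⟨
        c ∙ (x ∙ b ∙ x ∙ c)         ≈⟨ ∙-congˡ (assoc (x ∙ b) x c) ⟩
        c ∙ ((x ∙ b) ∙ (x ∙ c))     ≈⟨ ∙-congˡ xb-xc ⟩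
        c ∙ ((x ∙ c) ∙ (x ∙ b))     ≈⟨ assoc c (x ∙ c) (x ∙ b) ⟨
        c ∙ (x ∙ c) ∙ (x ∙ b)       ≈⟨ ∙-congʳ (assoc c x c) ⟨
        c ∙ x ∙ c ∙ (x ∙ b)         ≈⟨ ∙-congʳ cxc ⟩
        c ∙ (x ∙ b)                 ≈⟨ assoc c x b ⟨
        c ∙ x ∙ b                   ∎

    ⁻¹∙-≈-idempotent : ∀ x → x ⁻¹ ∙ x ≈ x ⁻¹ ∙ (x ⁻¹) ⁻¹
    ⁻¹∙-≈-idempotent x = ∙-congˡ (≈-sym (⁻¹-involutive x))

    regular⁻¹ : ∀ x → x ⁻¹ ∙ x ∙ x ⁻¹ ≈ x ⁻¹
    regular⁻¹ x = ≈-trans (∙-congʳ (⁻¹∙-≈-idempotent x)) (regular (x ⁻¹))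

    ⁻¹-cong : ∀ {x y} → x ≈ y → x ⁻¹ ≈ y ⁻¹
    ⁻¹-cong {x} {y} x≈y = inverse-unique (regular x) (regular⁻¹ x) xyx yxy
      (begin
        (x ⁻¹ ∙ x) ∙ (y ⁻¹ ∙ x)
          ≈⟨ ∙-cong (⁻¹∙-≈-idempotent x) (≈-trans (∙-congˡ x≈y) (⁻¹∙-≈-idempotent y)) ⟩
        (x ⁻¹ ∙ (x ⁻¹) ⁻¹) ∙ (y ⁻¹ ∙ (y ⁻¹) ⁻¹)
          ≈⟨ idempotents-comm (x ⁻¹) (y ⁻¹) ⟩
        (y ⁻¹ ∙ (y ⁻¹) ⁻¹) ∙ (x ⁻¹ ∙ (x ⁻¹) ⁻¹)
          ≈⟨ ∙-cong (≈-trans (∙-congˡ x≈y) (⁻¹∙-≈-idempotent y)) (⁻¹∙-≈-idempotent x) ⟨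
        (y ⁻¹ ∙ x) ∙ (x ⁻¹ ∙ x)                     ∎)
      (begin
        (x ∙ x ⁻¹) ∙ (x ∙ y ⁻¹)                     ≈⟨ ∙-congˡ (∙-congʳ x≈y) ⟩
        (x ∙ x ⁻¹) ∙ (y ∙ y ⁻¹)                     ≈⟨ idempotents-comm x y ⟩
        (y ∙ y ⁻¹) ∙ (x ∙ x ⁻¹)                     ≈⟨ ∙-congʳ (∙-congʳ x≈y) ⟨
        (x ∙ y ⁻¹) ∙ (x ∙ x ⁻¹)                     ∎)
      where
      xyx : x ∙ y ⁻¹ ∙ x ≈ x
      xyx = ≈-trans (∙-cong (∙-congʳ x≈y) x≈y) (≈-trans (regular y) (≈-sym x≈y))
      yxy : y ⁻¹ ∙ x ∙ y ⁻¹ ≈ y ⁻¹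
      yxy = ≈-trans (∙-congʳ (∙-congˡ x≈y)) (regular⁻¹ y)

-- Finite hereditary permutations modulo a λ-theory

record WTree : Set where
  constructor wtree
  field
    tree : Tree
    wf   : WF tree
open WTree

leafʷ : WTree
leafʷ = wtree leaf wf-leaf

infixl 7 _·_
_·_ : WTree → WTree → WTree
X · Y = wtree (tree X ⊙ tree Y) (WF-⊙ _ _ (wf X) (wf Y))

infix 8 _⁻¹
_⁻¹ : WTree → WTree
X ⁻¹ = wtree (inv (tree X)) (WF-inv _ (wf X))

ηnfʷ : WTree → WTree
ηnfʷ X = wtree (ηnf (tree X)) (WF-ηnf _ (wf X))

treeOf : ∀ {x} → FHP x → WTree
treeOf (_ , _ , _ , _ , h) = wtree (fromHP h) (WF-fromHP h)

=β-treeOf : ∀ {x} (px : FHP x) → x =β ⟦ tree (treeOf px) ⟧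
=β-treeOf {x} (_ , x=N , _ , refl , h) = subst (x =β_) (cong lam (term-fromHP h)) x=N

fhp : ∀ X → FHP ⟦ tree X ⟧
fhp X = ⟦ tree X ⟧ , ε , term 0 (tree X) , refl , toHP (tree X) 0 (wf X)

module InTheory {_≈_ : Rel Term 0ℓ} (λT : IsLambdaTheory _≈_) where
  open IsLambdaTheory λT
  open IsEquivalence isEquivalence renaming (refl to ≈-refl; sym to ≈-sym; trans to ≈-trans)

  ⟶*⇒≈ : ∀ {a b} → a ⟶* b → a ≈ b
  ⟶*⇒≈ = β⊆ ∘ ⟶*⇒=β

  ≡⇒≈ : ∀ {a b} → a ≡ b → a ≈ b
  ≡⇒≈ refl = ≈-refl

  Trivial : Set
  Trivial = ∀ a b → a ≈ b

  foldl-app-cong : ∀ {a b} xs → a ≈ b → foldl app a xs ≈ foldl app b xs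
  foldl-app-cong []       a≈b = a≈b
  foldl-app-cong (x ∷ xs) a≈b = foldl-app-cong xs (app-cong a≈b ≈-refl)

  -- Böhm's theorem for trees: a theory equating two apart trees equates 𝐓 and 𝐅.
  Apart-≈⇒Trivial : ∀ {X Y} → WF X → WF Y → Apart X Y → ⟦ X ⟧ ≈ ⟦ Y ⟧ → Trivial
  Apart-≈⇒Trivial {X} {Y} wfX wfY apart X≈Y a b =
    ≈-trans (≈-sym (⟶*⇒≈ 𝐓ab⟶*a)) (≈-trans (app-cong (app-cong 𝐓≈𝐅 ≈-refl) ≈-refl) (⟶*⇒≈ 𝐅ab⟶*b))
    where
    open Separation (separate wfX wfY apart)
    𝐓≈𝐅 : 𝐓 ≈ 𝐅
    𝐓≈𝐅 = ≈-trans (≈-sym (⟶*⇒≈ (foldl-app⟶*ˡ arguments (app-⟦⟧⟶* head wfX) ◅◅ left)))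
                  (≈-trans (foldl-app-cong arguments (app-cong X≈Y ≈-refl))
                           (⟶*⇒≈ (foldl-app⟶*ˡ arguments (app-⟦⟧⟶* head wfY) ◅◅ right)))
    𝐓ab⟶*a : app (app 𝐓 a) b ⟶* a
    𝐓ab⟶*a = appˡ* (β ◅ ε) ◅◅ β ◅ ≡⇒⟶* (trans (sub-ren _ suc a) (sub-id a))
    𝐅ab⟶*b : app (app 𝐅 a) b ⟶* b
    𝐅ab⟶*b = appˡ* (β ◅ ε) ◅◅ β ◅ ε

  infix 4 _≈ʷ_ _≈⟦_⟧
  _≈ʷ_ : Rel WTree 0ℓ
  X ≈ʷ Y = ⟦ tree X ⟧ ≈ ⟦ tree Y ⟧

  _≈⟦_⟧ : Term → WTree → Set
  x ≈⟦ X ⟧ = x ≈ ⟦ tree X ⟧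

  ≈ᵀ⇒≈ : ∀ {X Y} → X ≈ᵀ Y → ⟦ X ⟧ ≈ ⟦ Y ⟧
  ≈ᵀ⇒≈ = ≡⇒≈ ∘ ⟦⟧-cong

  ∘ₗ-· : ∀ {x y} X Y → x ≈⟦ X ⟧ → y ≈⟦ Y ⟧ → x ∘ₗ y ≈⟦ X · Y ⟧
  ∘ₗ-· X Y x≈X y≈Y = ≈-trans (app-cong (app-cong ≈-refl x≈X) y≈Y) (⟶*⇒≈ (⟦⟧-∘ₗ⟶* (wf X) (wf Y)))

  treeSemigroup : Semigroup 0ℓ 0ℓ
  treeSemigroup = record
    { Carrier     = WTree
    ; _≈_         = _≈ʷ_
    ; _∙_         = _·_
    ; isSemigroup = record
      { isMagma = record
        { isEquivalence = record { refl = ≈-refl ; sym = ≈-sym ; trans = ≈-trans }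
        ; ∙-cong        = λ {X} {X′} {Y} {Y′} X≈X′ Y≈Y′ →
                          ≈-trans (≈-sym (∘ₗ-· X Y ≈-refl ≈-refl)) (∘ₗ-· X′ Y′ X≈X′ Y≈Y′)
        }
      ; assoc   = λ X Y Z → ≈ᵀ⇒≈ (⊙-assoc (tree X) (tree Y) (tree Z))
      }
    }

  ·-regular : ∀ X → X · X ⁻¹ · X ≈ʷ X
  ·-regular X = ≈ᵀ⇒≈ (⊙-inv-⊙ (tree X) (wf X))

  ⁻¹-involutive : ∀ X → (X ⁻¹) ⁻¹ ≈ʷ X
  ⁻¹-involutive X = ≈ᵀ⇒≈ (inv-involutive (tree X) (wf X))

  ·-idempotents-comm : ∀ X Y → (X · X ⁻¹) · (Y · Y ⁻¹) ≈ʷ (Y · Y ⁻¹) · (X · X ⁻¹)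
  ·-idempotents-comm X Y =
    ≈ᵀ⇒≈ (HereditaryIdentity-⊙-comm _ _ (HereditaryIdentity-⊙-inv _ (wf X)) (HereditaryIdentity-⊙-inv _ (wf Y)))

  open InverseSemigroup.Properties treeSemigroup _⁻¹ ·-regular ⁻¹-involutive ·-idempotents-comm

  ≤ₙ-ηNormal : ∀ X Z → ηNormal (tree Z) → tree X ≈η tree Z → X ≤ₙ Z
  ≤ₙ-ηNormal X Z ηZ X≈Z = ≈ᵀ⇒≈ (⊙-inv-⊙-ηNormalˡ (tree X) (tree Z) (wf X) (wf Z) ηZ X≈Z)

  -- W ⊙ W⁻¹ ⊙ X is η-equivalent to X, so it is either η-equivalent or apart from W.
  ≤ₙ⇒≈η : ∀ W X → W ≤ₙ X → tree W ≈η tree X ⊎ Trivial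
  ≤ₙ⇒≈η W X W≤X with ≈η-or-Apart (tree (W · W ⁻¹ · X)) (tree W) (wf (W · W ⁻¹ · X)) (wf W)
  ... | inj₁ WW⁻¹X≈W = inj₁ (≈η-trans (≈η-sym WW⁻¹X≈W) (HereditaryIdentity-⊙ˡ-≈η _ _ (HereditaryIdentity-⊙-inv _ (wf W))))
  ... | inj₂ apart   = inj₂ (Apart-≈⇒Trivial (wf (W · W ⁻¹ · X)) (wf W) apart W≤X)

  ≈-via : ∀ {x y} X Y → x ≈⟦ X ⟧ → y ≈⟦ Y ⟧ → X ≈ʷ Y → x ≈ y
  ≈-via X Y x≈X y≈Y X≈Y = ≈-trans x≈X (≈-trans X≈Y (≈-sym y≈Y))

  represents : ∀ {x} (px : FHP x) → x ≈⟦ treeOf px ⟧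
  represents = β⊆ ∘ =β-treeOf

  star : (x : Term) → FHP x → Term
  star x px = ⟦ tree (treeOf px ⁻¹) ⟧

  star-represents : ∀ {x} X (px : FHP x) → x ≈⟦ X ⟧ → star x px ≈⟦ X ⁻¹ ⟧
  star-represents X px x≈X = ⁻¹-cong {treeOf px} {X} (≈-trans (≈-sym (represents px)) x≈X)

  FHP-𝐈 : ∃ λ z → FHP z × 𝐈 ≈ z
  FHP-𝐈 = 𝐈 , fhp leafʷ , ≈-refl

  FHP-∘ₗ : ∀ {x y} → FHP x → FHP y → ∃ λ z → FHP z × (x ∘ₗ y) ≈ z
  FHP-∘ₗ px py = _ , fhp (treeOf px · treeOf py) , ∘ₗ-· (treeOf px) (treeOf py) (represents px) (represents py)

  ∘ₗ-assoc : ∀ {x y z} → FHP x → FHP y → FHP z → ((x ∘ₗ y) ∘ₗ z) ≈ (x ∘ₗ (y ∘ₗ z))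
  ∘ₗ-assoc px py pz = ≈-via (X · Y · Z) (X · (Y · Z))
    (∘ₗ-· (X · Y) Z (∘ₗ-· X Y (represents px) (represents py)) (represents pz))
    (∘ₗ-· X (Y · Z) (represents px) (∘ₗ-· Y Z (represents py) (represents pz)))
    (≈ᵀ⇒≈ (⊙-assoc (tree X) (tree Y) (tree Z)))
    where X = treeOf px ; Y = treeOf py ; Z = treeOf pz

  ∘ₗ-identityˡ : ∀ {x} → FHP x → (𝐈 ∘ₗ x) ≈ x
  ∘ₗ-identityˡ px = ≈-trans (∘ₗ-· leafʷ (treeOf px) ≈-refl (represents px)) (≈-sym (represents px))

  ∘ₗ-identityʳ : ∀ {x} → FHP x → (x ∘ₗ 𝐈) ≈ x
  ∘ₗ-identityʳ px = ≈-via (X · leafʷ) X (∘ₗ-· X leafʷ (represents px) ≈-refl) (represents px)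
                          (≡⇒≈ (cong ⟦_⟧ (⊙-identityʳ (tree X))))
    where X = treeOf px

  FHP-star : ∀ {x} (px : FHP x) → FHP (star x px)
  FHP-star px = fhp (treeOf px ⁻¹)

  star-cong : ∀ {x y} (px : FHP x) (py : FHP y) → x ≈ y → star x px ≈ star y py
  star-cong px py x≈y = ≈-sym (star-represents (treeOf px) py (≈-trans (≈-sym x≈y) (represents px)))

  star-involutive : ∀ {x} (px : FHP x) → star (star x px) (FHP-star px) ≈ x
  star-involutive px = ≈-via ((X ⁻¹) ⁻¹) X (star-represents (X ⁻¹) (FHP-star px) ≈-refl) (represents px) (⁻¹-involutive X)
    where X = treeOf px

  star-anti : ∀ {x y z} (px : FHP x) (py : FHP y) (pz : FHP z) → (x ∘ₗ y) ≈ z → star z pz ≈ (star y py ∘ₗ star x px)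
  star-anti px py pz xy≈z = ≈-via ((X · Y) ⁻¹) (Y ⁻¹ · X ⁻¹)
    (star-represents (X · Y) pz (≈-trans (≈-sym xy≈z) (∘ₗ-· X Y (represents px) (represents py))))
    (∘ₗ-· (Y ⁻¹) (X ⁻¹) ≈-refl ≈-refl)
    (≈ᵀ⇒≈ (inv-⊙ (tree X) (tree Y) (wf X) (wf Y)))
    where X = treeOf px ; Y = treeOf py

  ∘ₗ-star-represents : ∀ {x} (px : FHP x) → x ∘ₗ star x px ≈⟦ treeOf px · treeOf px ⁻¹ ⟧
  ∘ₗ-star-represents px = ∘ₗ-· (treeOf px) (treeOf px ⁻¹) (represents px) ≈-refl

  ∘ₗ-regular : ∀ {x} (px : FHP x) → ((x ∘ₗ star x px) ∘ₗ x) ≈ x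
  ∘ₗ-regular px = ≈-via (X · X ⁻¹ · X) X (∘ₗ-· (X · X ⁻¹) X (∘ₗ-star-represents px) (represents px)) (represents px)
                        (·-regular X)
    where X = treeOf px

  idempotents-commute : ∀ {x y} (px : FHP x) (py : FHP y) →
                        ((x ∘ₗ star x px) ∘ₗ (y ∘ₗ star y py)) ≈ ((y ∘ₗ star y py) ∘ₗ (x ∘ₗ star x px))
  idempotents-commute px py = ≈-via ((X · X ⁻¹) · (Y · Y ⁻¹)) ((Y · Y ⁻¹) · (X · X ⁻¹))
    (∘ₗ-· (X · X ⁻¹) (Y · Y ⁻¹) (∘ₗ-star-represents px) (∘ₗ-star-represents py))
    (∘ₗ-· (Y · Y ⁻¹) (X · X ⁻¹) (∘ₗ-star-represents py) (∘ₗ-star-represents px))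
    (·-idempotents-comm X Y)
    where X = treeOf px ; Y = treeOf py

  infix 4 _≼_
  _≼_ : ∀ {u v} → FHP u → FHP v → Set
  _≼_ {u} {v} pu pv = ((u ∘ₗ star u pu) ∘ₗ v) ≈ u

  σ : ∀ {t u} → FHP t → FHP u → Set
  σ {t} {u} pt pu = ∃ λ w → Σ (FHP w) λ pw → (pw ≼ pt) × (pw ≼ pu)

  MaxInClass : ∀ {m u} → FHP m → FHP u → Set
  MaxInClass {m} pm pu = σ pm pu × (∀ {v} (pv : FHP v) → σ pv pu → pm ≼ pv → v ≈ m)

  ≼-represents : ∀ {u v} U V (pu : FHP u) → u ≈⟦ U ⟧ → v ≈⟦ V ⟧ → ((u ∘ₗ star u pu) ∘ₗ v) ≈⟦ U · U ⁻¹ · V ⟧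
  ≼-represents U V pu u≈U v≈V = ∘ₗ-· (U · U ⁻¹) V (∘ₗ-· U (U ⁻¹) u≈U (star-represents U pu u≈U)) v≈V

  ≤ₙ⇒≼ : ∀ {u v} U V (pu : FHP u) (pv : FHP v) → u ≈⟦ U ⟧ → v ≈⟦ V ⟧ → U ≤ₙ V → pu ≼ pv
  ≤ₙ⇒≼ U V pu pv u≈U v≈V = ≈-via (U · U ⁻¹ · V) U (≼-represents U V pu u≈U v≈V) u≈U

  ≼⇒≤ₙ : ∀ {u v} U V (pu : FHP u) (pv : FHP v) → u ≈⟦ U ⟧ → v ≈⟦ V ⟧ → pu ≼ pv → U ≤ₙ V
  ≼⇒≤ₙ U V pu pv u≈U v≈V u≼v = ≈-trans (≈-sym (≼-represents U V pu u≈U v≈V)) (≈-trans u≼v u≈U)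

  ηnf-σ : ∀ {u} (pu : FHP u) → σ (fhp (ηnfʷ (treeOf pu))) pu
  ηnf-σ pu = _ , pu , ≤ₙ⇒≼ U (ηnfʷ U) pu (fhp (ηnfʷ U)) (represents pu) ≈-refl
                         (≤ₙ-ηNormal U (ηnfʷ U) (ηNormal-ηnf (tree U)) (≈η-ηnf (tree U) (wf U)))
                   , ≤ₙ⇒≼ U U pu pu (represents pu) (represents pu) (·-regular U)
    where U = treeOf pu

  ηnf-maximum : ∀ {u v} (pu : FHP u) (pv : FHP v) → fhp (ηnfʷ (treeOf pu)) ≼ pv → v ≈ ⟦ ηnf (tree (treeOf pu)) ⟧
  ηnf-maximum pu pv M≼V with ≤ₙ⇒≈η M V (≼⇒≤ₙ M V (fhp M) pv ≈-refl (represents pv) M≼V)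
    where M = ηnfʷ (treeOf pu) ; V = treeOf pv
  ... | inj₂ trivial = trivial _ _
  ... | inj₁ M≈ηV    = ≈-trans (represents pv) (≤ₙ-antisym {V} {M} (≤ₙ-ηNormal V M (ηNormal-ηnf (tree (treeOf pu))) (≈η-sym M≈ηV)) M≤V)
    where
    M = ηnfʷ (treeOf pu)
    V = treeOf pv
    M≤V = ≼⇒≤ₙ M V (fhp M) pv ≈-refl (represents pv) M≼V

  -- All members of a σ-class are η-equivalent (unless the theory is trivial), hence below the η-normal form.
  maximal-unique : ∀ {u m′} (pu : FHP u) (pm′ : FHP m′) → MaxInClass pm′ pu → m′ ≈ ⟦ ηnf (tree (treeOf pu)) ⟧
  maximal-unique pu pm′ ((w , pw , W≼M′ , W≼U) , maximal)
    with ≤ₙ⇒≈η W M′ (≼⇒≤ₙ W M′ pw pm′ (represents pw) (represents pm′) W≼M′)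
       | ≤ₙ⇒≈η W U (≼⇒≤ₙ W U pw pu (represents pw) (represents pu) W≼U)
    where U = treeOf pu ; M′ = treeOf pm′ ; W = treeOf pw
  ... | inj₂ trivial | _            = trivial _ _
  ... | inj₁ _       | inj₂ trivial = trivial _ _
  ... | inj₁ W≈ηM′   | inj₁ W≈ηU    =
    ≈-sym (maximal (fhp M) (ηnf-σ pu) (≤ₙ⇒≼ M′ M pm′ (fhp M) (represents pm′) ≈-refl (≤ₙ-ηNormal M′ M (ηNormal-ηnf (tree U)) M′≈ηM)))
    where
    U = treeOf pu
    M = ηnfʷ U
    M′ = treeOf pm′
    M′≈ηM = ≈η-trans (≈η-sym W≈ηM′) (≈η-trans W≈ηU (≈η-ηnf (tree U) (wf U)))

  F-inverse : ∀ {u} (pu : FHP u) → ∃ λ m → Σ (FHP m) λ pm → MaxInClass pm pu × (∀ {m′} (pm′ : FHP m′) → MaxInClass pm′ pu → m′ ≈ m)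
  F-inverse pu = _ , fhp (ηnfʷ (treeOf pu)) , (ηnf-σ pu , λ pv _ → ηnf-maximum pu pv) , maximal-unique pu

theorem4p12 : (_≈_ : Rel Term 0ℓ) → IsLambdaTheory _≈_ →
    IsFInverseSubmonoid FHP _≈_ _∘ₗ_ 𝐈
theorem4p12 _≈_ λT = record
  { e∈        = FHP-𝐈
  ; ∙∈        = FHP-∘ₗ
  ; assoc     = ∘ₗ-assoc
  ; identityˡ = ∘ₗ-identityˡ
  ; identityʳ = ∘ₗ-identityʳ
  ; star      = star
  ; star∈     = FHP-star
  ; star-cong = star-cong
  ; star-inv  = star-involutive
  ; star-anti = star-anti
  ; regular   = ∘ₗ-regular
  ; idem-comm = idempotents-commute
  ; F-inverse = F-inverse
  }
  where open InTheory λT
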